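{- Let $n\ge1$ and $1\le k\le 2n$ be integers, let $U=\{u_1,\dots,u_n\}$, $V=\{v_1,\dots,v_n\}$ be the parts of $K_{n,n}$, and let $X^{u}_{n,k}\subseteq\mathbb{R}^{n^2}$ be the set of all vectors $x$ with $x_{i,j}=1$ if $u_i\in A$ and $v_j\in B$, $x_{i,j}=0$ otherwise, where $A\subseteq U$, $B\subseteq V$ range over all pairs with $|A|+|B|=k$. For $x\in X^u_{n,k}$ let $$K^{\max}_{n,k}(x)=\{c\in\mathbb{R}^{n^2}_{+}:\ \langle c,x\rangle\ge\langle c,y\rangle\ \text{for all } y\in X^u_{n,k}\},$$ and let the graph of the cone decomposition $K^{\max}_{n,k}$ have these cones as vertices, two cones $K^{\max}_{n,k}(x)$, $K^{\max}_{n,k}(y)$ ($x\ne y$) being adjacent iff $\dim\big(K^{\max}_{n,k}(x)\cap K^{\max}_{n,k}(y)\big)=n^2-1$. Then the clique number $\omega(K^{\max}_{n,k})$ of this graph satisfies $$\omega(K^{\max}_{n,k})\ge\binom{n}{s}=\Omega\!\left(\left(\frac{n}{s}\right)^{s}\right)\ \text{ if } k=2s,\qquad \omega(K^{\max}_{n,k})\ge\binom{n-1}{s}=\Omega\!\left(\left(\frac{n-1}{s}\right)^{s}\right)\ \text{ if } k=2s+1.$$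
   Context: $\mathbb{R}^{d}_{+}$ denotes the nonnegative orthant. The clique number of a graph is the maximum size of a set of pairwise adjacent vertices.
   Formalization: The vectors c defining the cones $K^{\max}_{n,k}(x)$, the dimension of their intersections and the equality of cones are taken over ℚ^(n²) rather than ℝ^(n²). -}

module Defs where

open import Data.Nat as ℕ using (ℕ; zero; suc)
open import Data.Fin using (Fin) renaming (zero to fzero; suc to fsuc)
open import Data.Fin.Subset using (Subset; ∣_∣)
open import Data.Vec using (lookup)
open import Data.Bool using (Bool; true; false; _∧_; if_then_else_)
open import Data.Rational as ℚ using (ℚ; 0ℚ; 1ℚ; _≤_; _+_; _*_)
open import Data.Product using (Σ; _×_; ∃; _,_)
open import Relation.Binary.PropositionalEquality using (_≡_)
open import Relation.Nullary using (¬_)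
open import Function.Bundles using (_⇔_)

sumFin : (m : ℕ) → (Fin m → ℚ) → ℚ
sumFin zero    f = 0ℚ
sumFin (suc m) f = f fzero + sumFin m (λ i → f (fsuc i))

Pt : ℕ → Set
Pt n = Fin n → Fin n → ℚ

⟨_,_⟩ : {n : ℕ} → Pt n → Pt n → ℚ
⟨_,_⟩ {n} c x = sumFin n (λ i → sumFin n (λ j → c i j * x i j))

Pair : ℕ → Set
Pair n = Subset n × Subset n

χ : {n : ℕ} → Pair n → Pt n
χ (A , B) i j = if lookup A i ∧ lookup B j then 1ℚ else 0ℚ

Admissible : {n : ℕ} → ℕ → Pair n → Set
Admissible k (A , B) = ∣ A ∣ ℕ.+ ∣ B ∣ ≡ k

InX : (n k : ℕ) → Pt n → Set
InX n k x = Σ (Pair n) (λ p → Admissible k p × χ p ≡ x)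

Kmax : (n k : ℕ) → Pt n → Pt n → Set
Kmax n k x c = (∀ i j → 0ℚ ≤ c i j)
             × (∀ y → InX n k y → ⟨ c , y ⟩ ≤ ⟨ c , x ⟩)

LinIndep : {n m : ℕ} → (Fin m → Pt n) → Set
LinIndep {n} {m} v = (a : Fin m → ℚ)
  → (∀ i j → sumFin m (λ l → a l * v l i j) ≡ 0ℚ)
  → ∀ l → a l ≡ 0ℚ

-- dimension (of the linear span) of a set S ⊆ ℚ^{n²} containing 0 is d
HasDim : {n : ℕ} → (Pt n → Set) → ℕ → Set
HasDim {n} S d =
    (Σ (Fin d → Pt n) (λ v → (∀ l → S (v l)) × LinIndep v))
  × (∀ (v : Fin (suc d) → Pt n) → (∀ l → S (v l)) → ¬ LinIndep v)

SameCone : (n k : ℕ) → Pt n → Pt n → Set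
SameCone n k x y = ∀ c → Kmax n k x c ⇔ Kmax n k y c

Adjacent : (n k : ℕ) → Pt n → Pt n → Set
Adjacent n k x y = ¬ SameCone n k x y
  × HasDim (λ c → Kmax n k x c × Kmax n k y c) (n ℕ.* n ℕ.∸ 1)

CliqueNumberAtLeast : (n k m : ℕ) → Set
CliqueNumberAtLeast n k m =
  Σ (Fin m → Pt n) (λ f → (∀ l → InX n k (f l))
     × (∀ l l′ → ¬ l ≡ l′ → Adjacent n k (f l) (f l′)))

-- Two points x ≠ y of X have adjacent cones as soon as some weight c₀ ≥ 0 is maximized over X
-- exactly at x and y, with a margin: perturbing c₀ along each of the n² − 1 coordinates other than
-- a coordinate p₀ where x and y differ, and compensating at p₀, gives n² − 1 independent vectors of
-- K(x) ∩ K(y), while K(x) ∩ K(y) lies in the hyperplane ⟨ c , x − y ⟩ = 0.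
-- For two rectangles P × Q and P′ × Q′ of maximal area |P||Q| among those with |C| + |D| = k, such a
-- weight is lexicographic: first the number of cells covered by P × Q ∪ P′ × Q′, which attains
-- |P||Q| only on maximal rectangles inside that union, then a tie-breaker.
-- For k = 2s the clique consists of the squares A × A over the s-subsets A of U; for k = 2s + 1 of
-- the rectangles ({u₀} ∪ A) × A over the s-subsets A of the other n − 1 vertices, where a
-- tie-breaker ignoring the row u₀ separates them from the s × (s + 1) rectangles in the union.

module Submission where

open import Defs
open import Data.Fin.Base using (Fin; zero; suc)
open import Data.Product.Base using (Σ; ∃; ∃₂; _×_; _,_; proj₁; proj₂; uncurry)
open import Data.Sum.Base using (_⊎_; inj₁; inj₂; [_,_]′)
open import Function.Base using (_∘_; id)
open import Relation.Binary.PropositionalEquality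
open import Relation.Nullary using (¬_; Dec; yes; no; ¬?; _×-dec_; _⊎-dec_; contradiction)
open import Relation.Nullary.Decidable using (decidable-stable)

module LinearAlgebra where

  open import Data.Nat.Base using (ℕ; zero; suc; _∸_) renaming (_*_ to _*ℕ_)
  open import Data.Fin.Base using (punchIn; punchOut; combine; remQuot)
  import Data.Fin.Properties as Fin
  open import Data.Rational.Base using (ℚ; 0ℚ; 1ℚ; _+_; _*_; _-_; -_; _≤_; 1/_; ≢-nonZero)
  import Data.Rational.Properties as ℚ
  open import Data.Rational.Solver using (module +-*-Solver)
  open +-*-Solver using (solve; _:+_; _:*_; _:-_; :-_; _:=_; con)
  open import Algebra.Bundles using (Ring)
  open import Algebra.Properties.Semiring.Sum (Ring.semiring ℚ.+-*-ring)
    using (sum; sum-cong-≗; sum-replicate-zero; ∑-distrib-+; ∑-comm; sum-remove; *-distribˡ-sum; *-distribʳ-sum)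
  open import Data.Product.Properties using (≡-dec)
  open import Data.Vec.Functional using (insertAt)
  open import Data.Vec.Functional.Properties using (insertAt-lookup; insertAt-punchIn)
  open import Relation.Binary.Definitions using (DecidableEquality)

  sumFin≡sum : ∀ m (f : Fin m → ℚ) → sumFin m f ≡ sum f
  sumFin≡sum zero    f = refl
  sumFin≡sum (suc m) f = cong (f zero +_) (sumFin≡sum m (f ∘ suc))

  sumFin-cong : ∀ m {f g : Fin m → ℚ} → (∀ i → f i ≡ g i) → sumFin m f ≡ sumFin m g
  sumFin-cong zero    f≗g = refl
  sumFin-cong (suc m) f≗g = cong₂ _+_ (f≗g zero) (sumFin-cong m (f≗g ∘ suc))

  sumFin-zero : ∀ m → sumFin m (λ _ → 0ℚ) ≡ 0ℚ
  sumFin-zero m = trans (sumFin≡sum m _) (sum-replicate-zero m)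

  sumFin-+ : ∀ m (f g : Fin m → ℚ) → sumFin m (λ i → f i + g i) ≡ sumFin m f + sumFin m g
  sumFin-+ m f g
    rewrite sumFin≡sum m (λ i → f i + g i) | sumFin≡sum m f | sumFin≡sum m g = ∑-distrib-+ f g

  sumFin-*ˡ : ∀ m c (f : Fin m → ℚ) → sumFin m (λ i → c * f i) ≡ c * sumFin m f
  sumFin-*ˡ m c f
    rewrite sumFin≡sum m (λ i → c * f i) | sumFin≡sum m f = sym (*-distribˡ-sum c f)

  sumFin-*ʳ : ∀ m c (f : Fin m → ℚ) → sumFin m (λ i → f i * c) ≡ sumFin m f * c
  sumFin-*ʳ m c f
    rewrite sumFin≡sum m (λ i → f i * c) | sumFin≡sum m f = sym (*-distribʳ-sum c f)

  sumFin-comm : ∀ m p (f : Fin m → Fin p → ℚ) →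
    sumFin m (λ i → sumFin p (f i)) ≡ sumFin p (λ j → sumFin m (λ i → f i j))
  sumFin-comm m p f = begin
    sumFin m (λ i → sumFin p (f i))         ≡⟨ sumFin≡sum m _ ⟩
    sum (λ i → sumFin p (f i))              ≡⟨ sum-cong-≗ (λ i → sumFin≡sum p (f i)) ⟩
    sum (λ i → sum (f i))                   ≡⟨ ∑-comm f ⟩
    sum (λ j → sum (λ i → f i j))           ≡⟨ sum-cong-≗ {p} (λ j → sumFin≡sum m (λ i → f i j)) ⟨
    sum (λ j → sumFin m (λ i → f i j))      ≡⟨ sumFin≡sum p _ ⟨
    sumFin p (λ j → sumFin m (λ i → f i j)) ∎
    where open ≡-Reasoning

  sumFin-remove : ∀ m (q : Fin (suc m)) (f : Fin (suc m) → ℚ) →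
    sumFin (suc m) f ≡ f q + sumFin m (f ∘ punchIn q)
  sumFin-remove m q f
    rewrite sumFin≡sum (suc m) f | sumFin≡sum m (f ∘ punchIn q) = sum-remove {i = q} f

  sumFin-single : ∀ m (q : Fin m) (f : Fin m → ℚ) → (∀ i → i ≢ q → f i ≡ 0ℚ) → sumFin m f ≡ f q
  sumFin-single (suc m) q f f≡0 = begin
    sumFin (suc m) f                  ≡⟨ sumFin-remove m q f ⟩
    f q + sumFin m (f ∘ punchIn q)    ≡⟨ cong (f q +_) (trans (sumFin-cong m off-q) (sumFin-zero m)) ⟩
    f q + 0ℚ                          ≡⟨ ℚ.+-identityʳ (f q) ⟩
    f q                               ∎
    where
    open ≡-Reasoning
    off-q : ∀ i → f (punchIn q i) ≡ 0ℚ
    off-q i = f≡0 (punchIn q i) (Fin.punchInᵢ≢i q i)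

  sumFin-nonNeg : ∀ m (f : Fin m → ℚ) → (∀ i → 0ℚ ≤ f i) → 0ℚ ≤ sumFin m f
  sumFin-nonNeg zero    f 0≤f = ℚ.≤-refl
  sumFin-nonNeg (suc m) f 0≤f = ℚ.+-mono-≤ (0≤f zero) (sumFin-nonNeg m (f ∘ suc) (0≤f ∘ suc))

  p≢0⇒p*q≡0⇒q≡0 : ∀ {p q} → p ≢ 0ℚ → p * q ≡ 0ℚ → q ≡ 0ℚ
  p≢0⇒p*q≡0⇒q≡0 {p} {q} p≢0 pq≡0 = begin
    q                ≡⟨ ℚ.*-identityˡ q ⟨
    1ℚ * q           ≡⟨ cong (_* q) (ℚ.*-inverseˡ p) ⟨
    1/ p * p * q     ≡⟨ ℚ.*-assoc (1/ p) p q ⟩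
    1/ p * (p * q)   ≡⟨ cong (1/ p *_) pq≡0 ⟩
    1/ p * 0ℚ        ≡⟨ ℚ.*-zeroʳ (1/ p) ⟩
    0ℚ               ∎
    where open ≡-Reasoning; instance _ = ≢-nonZero p≢0

  NontrivialSolution : (m p : ℕ) → (Fin m → Fin p → ℚ) → Set
  NontrivialSolution m p M = Σ (Fin p → ℚ) λ a →
    (∃ λ l → a l ≢ 0ℚ) × (∀ r → sumFin p (λ l → a l * M r l) ≡ 0ℚ)

  zero-row-step : ∀ {m p} (M : Fin (suc m) → Fin (suc p) → ℚ) → (∀ l → M zero l ≡ 0ℚ) →
    NontrivialSolution m p (λ r c → M (suc r) (suc c)) → NontrivialSolution (suc m) (suc p) M
  zero-row-step {m} {p} M M₀≡0 (b , (l , bₗ≢0) , bM≡0) = a , (suc l , bₗ≢0) , aM≡0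
    where
    a : Fin (suc p) → ℚ
    a = insertAt b zero 0ℚ
    aM≡0 : ∀ r → sumFin (suc p) (λ l → a l * M r l) ≡ 0ℚ
    aM≡0 zero    = trans (sumFin-cong (suc p) λ l → trans (cong (a l *_) (M₀≡0 l)) (ℚ.*-zeroʳ (a l)))
                         (sumFin-zero (suc p))
    aM≡0 (suc r) = trans (cong (_+ sumFin p (λ c → b c * M (suc r) (suc c))) (ℚ.*-zeroˡ (M (suc r) zero)))
                         (trans (ℚ.+-identityˡ _) (bM≡0 r))

  eliminate : ∀ {m p} → (Fin (suc m) → Fin (suc p) → ℚ) → Fin (suc p) → Fin m → Fin p → ℚ
  eliminate M q r c = M zero q * M (suc r) (punchIn q c) - M (suc r) q * M zero (punchIn q c)

  pivot-step : ∀ {m p} (M : Fin (suc m) → Fin (suc p) → ℚ) (q : Fin (suc p)) → M zero q ≢ 0ℚ →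
    NontrivialSolution m p (eliminate M q) → NontrivialSolution (suc m) (suc p) M
  pivot-step {m} {p} M q κ≢0 (b , (l , bₗ≢0) , bN≡0) = a , (punchIn q l , aₗ≢0) , aM≡0
    where
    open ≡-Reasoning
    κ = M zero q
    T = sumFin p (λ c → b c * M zero (punchIn q c))
    a : Fin (suc p) → ℚ
    a = insertAt (λ c → κ * b c) q (- T)
    aₗ≢0 : a (punchIn q l) ≢ 0ℚ
    aₗ≢0 aₗ≡0 = bₗ≢0 (p≢0⇒p*q≡0⇒q≡0 κ≢0 (trans (sym (insertAt-punchIn _ q (- T) l)) aₗ≡0))
    expand : ∀ (G : Fin (suc p) → ℚ) → sumFin (suc p) (λ l → a l * G l)
           ≡ - T * G q + κ * sumFin p (λ c → b c * G (punchIn q c))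
    expand G = begin
      sumFin (suc p) (λ l → a l * G l)
        ≡⟨ sumFin-remove p q (λ l → a l * G l) ⟩
      a q * G q + sumFin p (λ c → a (punchIn q c) * G (punchIn q c))
        ≡⟨ cong₂ _+_ (cong (_* G q) (insertAt-lookup _ q (- T)))
                     (sumFin-cong p λ c → trans (cong (_* G (punchIn q c)) (insertAt-punchIn _ q (- T) c))
                                                (ℚ.*-assoc κ (b c) (G (punchIn q c)))) ⟩
      - T * G q + sumFin p (λ c → κ * (b c * G (punchIn q c)))
        ≡⟨ cong (- T * G q +_) (sumFin-*ˡ p κ (λ c → b c * G (punchIn q c))) ⟩
      - T * G q + κ * sumFin p (λ c → b c * G (punchIn q c)) ∎
    aM≡0 : ∀ r → sumFin (suc p) (λ l → a l * M r l) ≡ 0ℚ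
    aM≡0 zero    = trans (expand (M zero)) (solve 2 (λ t k → (:- t) :* k :+ k :* t := con 0ℚ) refl T κ)
    aM≡0 (suc r) = begin
      sumFin (suc p) (λ l → a l * M (suc r) l)
        ≡⟨ expand (M (suc r)) ⟩
      - T * M (suc r) q + κ * S
        ≡⟨ solve 4 (λ t k m s → (:- t) :* m :+ k :* s := k :* s :+ (:- m) :* t) refl T κ (M (suc r) q) S ⟩
      κ * S + (- M (suc r) q) * T
        ≡⟨ cong₂ _+_ (sumFin-*ˡ p κ _) (sumFin-*ˡ p (- M (suc r) q) _) ⟨
      sumFin p (λ c → κ * (b c * M (suc r) (punchIn q c)))
        + sumFin p (λ c → (- M (suc r) q) * (b c * M zero (punchIn q c)))
        ≡⟨ sumFin-+ p _ _ ⟨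
      sumFin p (λ c → κ * (b c * M (suc r) (punchIn q c)) + (- M (suc r) q) * (b c * M zero (punchIn q c)))
        ≡⟨ sumFin-cong p (λ c → solve 5 (λ k b x m y → k :* (b :* x) :+ (:- m) :* (b :* y) := b :* (k :* x :- m :* y))
                                          refl κ (b c) (M (suc r) (punchIn q c)) (M (suc r) q) (M zero (punchIn q c))) ⟩
      sumFin p (λ c → b c * eliminate M q r c)
        ≡⟨ bN≡0 r ⟩
      0ℚ ∎
      where S = sumFin p (λ c → b c * M (suc r) (punchIn q c))

  homogeneous-solvable : ∀ m (M : Fin m → Fin (suc m) → ℚ) → NontrivialSolution m (suc m) M
  homogeneous-solvable zero    M = (λ _ → 1ℚ) , (zero , λ ()) , λ ()
  homogeneous-solvable (suc m) M with Fin.any? (λ q → ¬? (M zero q ℚ.≟ 0ℚ))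
  ... | yes (q , κ≢0) = pivot-step M q κ≢0 (homogeneous-solvable m (eliminate M q))
  ... | no  ¬pivot    = zero-row-step M M₀≡0 (homogeneous-solvable m (λ r c → M (suc r) (suc c)))
    where
    M₀≡0 : ∀ l → M zero l ≡ 0ℚ
    M₀≡0 l = decidable-stable (M zero l ℚ.≟ 0ℚ) (λ M₀≢0 → ¬pivot (l , M₀≢0))

  Idx : ℕ → Set
  Idx n = Fin n × Fin n

  at : ∀ {n} → Pt n → Idx n → ℚ
  at z p = z (proj₁ p) (proj₂ p)

  _≟ᵢ_ : ∀ {n} → DecidableEquality (Idx n)
  _≟ᵢ_ = ≡-dec Fin._≟_ Fin._≟_

  unit : ∀ {n} → Idx n → Pt n
  unit p i j with (i , j) ≟ᵢ p
  ... | yes _ = 1ℚ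
  ... | no  _ = 0ℚ

  unit-diag : ∀ {n} (p : Idx n) → at (unit p) p ≡ 1ℚ
  unit-diag p with p ≟ᵢ p
  ... | yes _   = refl
  ... | no  p≢p = contradiction refl p≢p

  unit-off : ∀ {n} (p : Idx n) i j → (i , j) ≢ p → unit p i j ≡ 0ℚ
  unit-off p i j ij≢p with (i , j) ≟ᵢ p
  ... | yes ij≡p = contradiction ij≡p ij≢p
  ... | no  _    = refl

  0≤unit : ∀ {n} (p : Idx n) i j → 0ℚ ≤ unit p i j
  0≤unit p i j with (i , j) ≟ᵢ p
  ... | yes _ = ℚ.≤ᵇ⇒≤ _
  ... | no  _ = ℚ.≤-refl

  _⊕_ : ∀ {n} → Pt n → Pt n → Pt n
  (c ⊕ d) i j = c i j + d i j

  _⊙_ : ∀ {n} → ℚ → Pt n → Pt n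
  (t ⊙ c) i j = t * c i j

  ⟨⟩-distrib-⊕ : ∀ {n} (c d z : Pt n) → ⟨ c ⊕ d , z ⟩ ≡ ⟨ c , z ⟩ + ⟨ d , z ⟩
  ⟨⟩-distrib-⊕ {n} c d z = begin
    sumFin n (λ i → sumFin n (λ j → (c i j + d i j) * z i j))
      ≡⟨ sumFin-cong n (λ i → trans (sumFin-cong n λ j → ℚ.*-distribʳ-+ (z i j) (c i j) (d i j)) (sumFin-+ n _ _)) ⟩
    sumFin n (λ i → sumFin n (λ j → c i j * z i j) + sumFin n (λ j → d i j * z i j))
      ≡⟨ sumFin-+ n _ _ ⟩
    ⟨ c , z ⟩ + ⟨ d , z ⟩ ∎
    where open ≡-Reasoning

  ⟨⟩-⊙ : ∀ {n} t (c z : Pt n) → ⟨ t ⊙ c , z ⟩ ≡ t * ⟨ c , z ⟩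
  ⟨⟩-⊙ {n} t c z = begin
    sumFin n (λ i → sumFin n (λ j → t * c i j * z i j))
      ≡⟨ sumFin-cong n (λ i → trans (sumFin-cong n λ j → ℚ.*-assoc t (c i j) (z i j)) (sumFin-*ˡ n t _)) ⟩
    sumFin n (λ i → t * sumFin n (λ j → c i j * z i j))
      ≡⟨ sumFin-*ˡ n t _ ⟩
    t * ⟨ c , z ⟩ ∎
    where open ≡-Reasoning

  ⟨⟩-linear : ∀ {n} m (a : Fin m → ℚ) (v : Fin m → Pt n) (z : Pt n) →
    ⟨ (λ i j → sumFin m (λ l → a l * v l i j)) , z ⟩ ≡ sumFin m (λ l → a l * ⟨ v l , z ⟩)
  ⟨⟩-linear {n} m a v z = begin
    sumFin n (λ i → sumFin n (λ j → sumFin m (λ l → a l * v l i j) * z i j))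
      ≡⟨ sumFin-cong n (λ i → sumFin-cong n λ j → sumFin-*ʳ m (z i j) _) ⟨
    sumFin n (λ i → sumFin n (λ j → sumFin m (λ l → a l * v l i j * z i j)))
      ≡⟨ sumFin-cong n (λ i → sumFin-comm n m _) ⟩
    sumFin n (λ i → sumFin m (λ l → sumFin n (λ j → a l * v l i j * z i j)))
      ≡⟨ sumFin-comm n m _ ⟩
    sumFin m (λ l → ⟨ a l ⊙ v l , z ⟩)
      ≡⟨ sumFin-cong m (λ l → ⟨⟩-⊙ (a l) (v l) z) ⟩
    sumFin m (λ l → a l * ⟨ v l , z ⟩) ∎
    where open ≡-Reasoning

  ⟨⟩-supported : ∀ {n} (p : Idx n) (c z : Pt n) → (∀ i j → (i , j) ≢ p → c i j ≡ 0ℚ) →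
    ⟨ c , z ⟩ ≡ at c p * at z p
  ⟨⟩-supported {n} (a , b) c z c≡0 = trans
    (sumFin-single n a _ λ i i≢a → trans (sumFin-cong n λ j → vanish i j (i≢a ∘ cong proj₁)) (sumFin-zero n))
    (sumFin-single n b _ λ j j≢b → vanish a j (j≢b ∘ cong proj₂))
    where
    vanish : ∀ i j → (i , j) ≢ (a , b) → c i j * z i j ≡ 0ℚ
    vanish i j ij≢ab = trans (cong (_* z i j) (c≡0 i j ij≢ab)) (ℚ.*-zeroˡ (z i j))

  ⟨unit⟩ : ∀ {n} (p : Idx n) (z : Pt n) → ⟨ unit p , z ⟩ ≡ at z p
  ⟨unit⟩ p z = trans (⟨⟩-supported p (unit p) z (unit-off p))
                     (trans (cong (_* at z p) (unit-diag p)) (ℚ.*-identityˡ (at z p)))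

  module _ {n : ℕ} where

    private
      flat : Idx (suc n) → Fin (suc n *ℕ suc n)
      flat = uncurry combine

      flat-injective : ∀ {p q} → flat p ≡ flat q → p ≡ q
      flat-injective {p} {q} eq = trans (sym (Fin.remQuot-combine (proj₁ p) (proj₂ p)))
                                 (trans (cong (remQuot (suc n)) eq) (Fin.remQuot-combine (proj₁ q) (proj₂ q)))

    punchIn² : Idx (suc n) → Fin (suc n *ℕ suc n ∸ 1) → Idx (suc n)
    punchIn² p r = remQuot (suc n) (punchIn (flat p) r)

    private
      flat-punchIn² : ∀ p r → flat (punchIn² p r) ≡ punchIn (flat p) r
      flat-punchIn² p r = Fin.combine-remQuot {suc n} (suc n) (punchIn (flat p) r)

    punchIn²ᵢ≢i : ∀ p r → punchIn² p r ≢ p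
    punchIn²ᵢ≢i p r eq = Fin.punchInᵢ≢i (flat p) r (trans (sym (flat-punchIn² p r)) (cong flat eq))

    punchIn²-injective : ∀ p r s → punchIn² p r ≡ punchIn² p s → r ≡ s
    punchIn²-injective p r s eq = Fin.punchIn-injective (flat p) r s
      (trans (sym (flat-punchIn² p r)) (trans (cong flat eq) (flat-punchIn² p s)))

    punchIn²-surjective : ∀ p q → q ≢ p → ∃ λ r → punchIn² p r ≡ q
    punchIn²-surjective p q q≢p = punchOut p≢q , flat-injective (trans (flat-punchIn² p _) (Fin.punchIn-punchOut p≢q))
      where
      p≢q : flat p ≢ flat q
      p≢q = q≢p ∘ sym ∘ flat-injective

open LinearAlgebra

module Facets where

  open import Data.Nat.Base using (ℕ; suc; _∸_) renaming (_*_ to _*ℕ_)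
  open import Data.Vec.Base using (lookup)
  open import Data.Bool.Base using (true; false; _∧_)
  open import Data.Rational.Base using (ℚ; 0ℚ; 1ℚ; _+_; _*_; _-_; -_; _≤_)
  import Data.Rational.Properties as ℚ
  open import Data.Rational.Solver using (module +-*-Solver)
  open +-*-Solver using (solve; _:+_; _:*_; _:-_; :-_; _:=_; con)
  open import Function.Bundles using (Equivalence)

  data Bit : ℚ → Set where
    bit0 : Bit 0ℚ
    bit1 : Bit 1ℚ

  χ-bit : ∀ {n} (p : Pair n) i j → Bit (χ p i j)
  χ-bit (A , B) i j with lookup A i ∧ lookup B j
  ... | true  = bit1
  ... | false = bit0

  InX-bit : ∀ {n k z} → InX n k z → ∀ q → Bit (at z q)
  InX-bit (p , _ , refl) (i , j) = χ-bit p i j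

  bit≤1 : ∀ {e} → Bit e → e ≤ 1ℚ
  bit≤1 bit0 = ℚ.≤ᵇ⇒≤ _
  bit≤1 bit1 = ℚ.≤ᵇ⇒≤ _

  difference-bound : ∀ {a b c} → Bit a → Bit b → Bit c → (b - a) * c ≤ b
  difference-bound bit0 bit0 bit0 = ℚ.≤ᵇ⇒≤ _
  difference-bound bit0 bit0 bit1 = ℚ.≤ᵇ⇒≤ _
  difference-bound bit0 bit1 bit0 = ℚ.≤ᵇ⇒≤ _
  difference-bound bit0 bit1 bit1 = ℚ.≤ᵇ⇒≤ _
  difference-bound bit1 bit0 bit0 = ℚ.≤ᵇ⇒≤ _
  difference-bound bit1 bit0 bit1 = ℚ.≤ᵇ⇒≤ _
  difference-bound bit1 bit1 bit0 = ℚ.≤ᵇ⇒≤ _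
  difference-bound bit1 bit1 bit1 = ℚ.≤ᵇ⇒≤ _

  1+difference-nonNeg : ∀ {a b} → Bit a → Bit b → 0ℚ ≤ 1ℚ + (b - a)
  1+difference-nonNeg bit0 bit0 = ℚ.≤ᵇ⇒≤ _
  1+difference-nonNeg bit0 bit1 = ℚ.≤ᵇ⇒≤ _
  1+difference-nonNeg bit1 bit0 = ℚ.≤ᵇ⇒≤ _
  1+difference-nonNeg bit1 bit1 = ℚ.≤ᵇ⇒≤ _

  -- The margin 1 absorbs the perturbations below, which change ⟨ · , z ⟩ − ⟨ · , x ⟩ by at most 1 on
  -- 0/1 points, and c₀[p₀] ≥ 1 keeps c₀ nonnegative when p₀ is compensated by −1.
  record FacetWitness (n k : ℕ) (x y : Pt n) : Set where
    field
      p₀      : Idx n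
      x[p₀]≡1 : at x p₀ ≡ 1ℚ
      y[p₀]≡0 : at y p₀ ≡ 0ℚ
      c₀      : Pt n
      c₀≥0    : ∀ i j → 0ℚ ≤ c₀ i j
      c₀[p₀]≥1 : 1ℚ ≤ at c₀ p₀
      c₀-tie  : ⟨ c₀ , y ⟩ ≡ ⟨ c₀ , x ⟩
      c₀-gap  : ∀ z → InX n k z → z ≡ x ⊎ z ≡ y ⊎ ⟨ c₀ , z ⟩ + 1ℚ ≤ ⟨ c₀ , x ⟩

  module _ {n k : ℕ} {x y : Pt (suc n)} (x∈X : InX (suc n) k x) (y∈X : InX (suc n) k y)
           (w : FacetWitness (suc n) k x y) where

    open FacetWitness w
    open ℚ.≤-Reasoning

    private
      B = ⟨ c₀ , x ⟩
      m = suc n *ℕ suc n ∸ 1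

    perturbed-∈K : ∀ {t} u → ⟨ c₀ , t ⟩ ≡ B → (∀ i j → 0ℚ ≤ c₀ i j + u i j) →
      ⟨ u , x ⟩ ≤ ⟨ u , t ⟩ → ⟨ u , y ⟩ ≤ ⟨ u , t ⟩ → (∀ z → InX (suc n) k z → ⟨ u , z ⟩ ≤ 1ℚ + ⟨ u , t ⟩) →
      Kmax (suc n) k t (c₀ ⊕ u)
    perturbed-∈K {t} u c₀t≡B c₀+u≥0 ux≤ut uy≤ut uz≤1+ut = c₀+u≥0 , λ z z∈X → begin
      ⟨ c₀ ⊕ u , z ⟩         ≡⟨ ⟨⟩-distrib-⊕ c₀ u z ⟩
      ⟨ c₀ , z ⟩ + ⟨ u , z ⟩ ≤⟨ bound z z∈X (c₀-gap z z∈X) ⟩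
      B + ⟨ u , t ⟩          ≡⟨ cong (_+ ⟨ u , t ⟩) c₀t≡B ⟨
      ⟨ c₀ , t ⟩ + ⟨ u , t ⟩ ≡⟨ ⟨⟩-distrib-⊕ c₀ u t ⟨
      ⟨ c₀ ⊕ u , t ⟩         ∎
      where
      bound : ∀ z → InX (suc n) k z → z ≡ x ⊎ z ≡ y ⊎ ⟨ c₀ , z ⟩ + 1ℚ ≤ B → ⟨ c₀ , z ⟩ + ⟨ u , z ⟩ ≤ B + ⟨ u , t ⟩
      bound z _ (inj₁ refl)        = ℚ.+-monoʳ-≤ B ux≤ut
      bound z _ (inj₂ (inj₁ refl)) = subst (λ b → b + ⟨ u , y ⟩ ≤ B + ⟨ u , t ⟩) (sym c₀-tie) (ℚ.+-monoʳ-≤ B uy≤ut)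
      bound z z∈X (inj₂ (inj₂ gap)) = begin
        ⟨ c₀ , z ⟩ + ⟨ u , z ⟩         ≤⟨ ℚ.+-monoʳ-≤ ⟨ c₀ , z ⟩ (uz≤1+ut z z∈X) ⟩
        ⟨ c₀ , z ⟩ + (1ℚ + ⟨ u , t ⟩)  ≡⟨ ℚ.+-assoc ⟨ c₀ , z ⟩ 1ℚ ⟨ u , t ⟩ ⟨
        ⟨ c₀ , z ⟩ + 1ℚ + ⟨ u , t ⟩    ≤⟨ ℚ.+-monoˡ-≤ ⟨ u , t ⟩ gap ⟩
        B + ⟨ u , t ⟩                  ∎

    private
      ρ : Fin m → Idx (suc n)
      ρ = punchIn² p₀

      δ : Fin m → ℚ
      δ r = at y (ρ r) - at x (ρ r)

      -- Raise the coordinate ρ r and compensate at p₀ so that ⟨ u r , x ⟩ = ⟨ u r , y ⟩.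
      u : Fin m → Pt (suc n)
      u r = unit (ρ r) ⊕ (δ r ⊙ unit p₀)

      1≰0 : ¬ (1ℚ ≤ 0ℚ)
      1≰0 = ℚ.≤⇒≤ᵇ

    ⟨u⟩ : ∀ r z → ⟨ u r , z ⟩ ≡ at z (ρ r) + δ r * at z p₀
    ⟨u⟩ r z = trans (⟨⟩-distrib-⊕ (unit (ρ r)) (δ r ⊙ unit p₀) z)
                    (cong₂ _+_ (⟨unit⟩ (ρ r) z) (trans (⟨⟩-⊙ (δ r) (unit p₀) z) (cong (δ r *_) (⟨unit⟩ p₀ z))))

    ⟨u,x⟩ : ∀ r → ⟨ u r , x ⟩ ≡ at y (ρ r)
    ⟨u,x⟩ r = begin-equality
      ⟨ u r , x ⟩                                   ≡⟨ ⟨u⟩ r x ⟩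
      at x (ρ r) + δ r * at x p₀                    ≡⟨ cong (λ e → at x (ρ r) + δ r * e) x[p₀]≡1 ⟩
      at x (ρ r) + (at y (ρ r) - at x (ρ r)) * 1ℚ
        ≡⟨ solve 2 (λ a b → a :+ (b :- a) :* con 1ℚ := b) refl (at x (ρ r)) (at y (ρ r)) ⟩
      at y (ρ r)                                    ∎

    ⟨u,y⟩ : ∀ r → ⟨ u r , y ⟩ ≡ at y (ρ r)
    ⟨u,y⟩ r = begin-equality
      ⟨ u r , y ⟩                  ≡⟨ ⟨u⟩ r y ⟩
      at y (ρ r) + δ r * at y p₀   ≡⟨ cong (λ e → at y (ρ r) + δ r * e) y[p₀]≡0 ⟩
      at y (ρ r) + δ r * 0ℚ        ≡⟨ cong (at y (ρ r) +_) (ℚ.*-zeroʳ (δ r)) ⟩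
      at y (ρ r) + 0ℚ              ≡⟨ ℚ.+-identityʳ (at y (ρ r)) ⟩
      at y (ρ r)                   ∎

    ⟨u,z⟩≤ : ∀ r z → InX (suc n) k z → ⟨ u r , z ⟩ ≤ 1ℚ + at y (ρ r)
    ⟨u,z⟩≤ r z z∈X = begin
      ⟨ u r , z ⟩                  ≡⟨ ⟨u⟩ r z ⟩
      at z (ρ r) + δ r * at z p₀
        ≤⟨ ℚ.+-mono-≤ (bit≤1 (InX-bit z∈X (ρ r)))
                      (difference-bound (InX-bit x∈X (ρ r)) (InX-bit y∈X (ρ r)) (InX-bit z∈X p₀)) ⟩
      1ℚ + at y (ρ r)              ∎

    c₀+u≥0 : ∀ r i j → 0ℚ ≤ c₀ i j + u r i j
    c₀+u≥0 r i j = by-cases ((i , j) ≟ᵢ p₀)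
      where
      u[p₀]≡δ : at (u r) p₀ ≡ δ r
      u[p₀]≡δ = begin-equality
        at (unit (ρ r)) p₀ + δ r * at (unit p₀) p₀
          ≡⟨ cong₂ (λ a b → a + δ r * b) (unit-off (ρ r) _ _ (punchIn²ᵢ≢i p₀ r ∘ sym)) (unit-diag p₀) ⟩
        0ℚ + δ r * 1ℚ
          ≡⟨ solve 1 (λ d → con 0ℚ :+ d :* con 1ℚ := d) refl (δ r) ⟩
        δ r ∎
      by-cases : Dec ((i , j) ≡ p₀) → 0ℚ ≤ c₀ i j + u r i j
      by-cases (yes ij≡p₀) = subst (λ q → 0ℚ ≤ at c₀ q + at (u r) q) (sym ij≡p₀) (begin
        0ℚ                       ≤⟨ 1+difference-nonNeg (InX-bit x∈X (ρ r)) (InX-bit y∈X (ρ r)) ⟩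
        1ℚ + δ r                 ≤⟨ ℚ.+-monoˡ-≤ (δ r) c₀[p₀]≥1 ⟩
        at c₀ p₀ + δ r           ≡⟨ cong (at c₀ p₀ +_) u[p₀]≡δ ⟨
        at c₀ p₀ + at (u r) p₀   ∎)
      by-cases (no ij≢p₀) = begin
        0ℚ
          ≤⟨ ℚ.+-mono-≤ (c₀≥0 i j) (0≤unit (ρ r) i j) ⟩
        c₀ i j + unit (ρ r) i j
          ≡⟨ solve 3 (λ c e d → c :+ e := c :+ (e :+ d :* con 0ℚ)) refl (c₀ i j) (unit (ρ r) i j) (δ r) ⟩
        c₀ i j + (unit (ρ r) i j + δ r * 0ℚ)
          ≡⟨ cong (λ e → c₀ i j + (unit (ρ r) i j + δ r * e)) (unit-off p₀ i j ij≢p₀) ⟨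
        c₀ i j + u r i j ∎

    private
      v : Fin m → Pt (suc n)
      v r = c₀ ⊕ u r

    v∈K : ∀ r → Kmax (suc n) k x (v r) × Kmax (suc n) k y (v r)
    v∈K r = perturbed-∈K {x} (u r) refl (c₀+u≥0 r) ℚ.≤-refl (ℚ.≤-reflexive (trans (⟨u,y⟩ r) (sym (⟨u,x⟩ r))))
                         (λ z z∈X → subst (λ e → ⟨ u r , z ⟩ ≤ 1ℚ + e) (sym (⟨u,x⟩ r)) (⟨u,z⟩≤ r z z∈X))
          , perturbed-∈K {y} (u r) c₀-tie (c₀+u≥0 r) (ℚ.≤-reflexive (trans (⟨u,x⟩ r) (sym (⟨u,y⟩ r)))) ℚ.≤-refl
                         (λ z z∈X → subst (λ e → ⟨ u r , z ⟩ ≤ 1ℚ + e) (sym (⟨u,y⟩ r)) (⟨u,z⟩≤ r z z∈X))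

    private
      v[ρ] : ∀ (a : Fin m → ℚ) r →
        sumFin m (λ l → a l * at (v l) (ρ r)) ≡ sumFin m a * at c₀ (ρ r) + a r
      v[ρ] a r = begin-equality
        sumFin m (λ l → a l * at (v l) (ρ r))
          ≡⟨ sumFin-cong m split ⟩
        sumFin m (λ l → a l * at c₀ (ρ r) + a l * at (unit (ρ l)) (ρ r))
          ≡⟨ sumFin-+ m _ _ ⟩
        sumFin m (λ l → a l * at c₀ (ρ r)) + sumFin m (λ l → a l * at (unit (ρ l)) (ρ r))
          ≡⟨ cong₂ _+_ (sumFin-*ʳ m (at c₀ (ρ r)) a) (sumFin-single m r _ off-diagonal) ⟩
        sumFin m a * at c₀ (ρ r) + a r * at (unit (ρ r)) (ρ r)
          ≡⟨ cong (λ e → sumFin m a * at c₀ (ρ r) + a r * e) (unit-diag (ρ r)) ⟩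
        sumFin m a * at c₀ (ρ r) + a r * 1ℚ
          ≡⟨ cong (sumFin m a * at c₀ (ρ r) +_) (ℚ.*-identityʳ (a r)) ⟩
        sumFin m a * at c₀ (ρ r) + a r ∎
        where
        p₀-entry : at (unit p₀) (ρ r) ≡ 0ℚ
        p₀-entry = unit-off p₀ _ _ (punchIn²ᵢ≢i p₀ r)
        split : ∀ l → a l * at (v l) (ρ r) ≡ a l * at c₀ (ρ r) + a l * at (unit (ρ l)) (ρ r)
        split l = begin-equality
          a l * (at c₀ (ρ r) + (at (unit (ρ l)) (ρ r) + δ l * at (unit p₀) (ρ r)))
            ≡⟨ cong (λ e → a l * (at c₀ (ρ r) + (at (unit (ρ l)) (ρ r) + δ l * e))) p₀-entry ⟩
          a l * (at c₀ (ρ r) + (at (unit (ρ l)) (ρ r) + δ l * 0ℚ))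
            ≡⟨ solve 4 (λ a c e d → a :* (c :+ (e :+ d :* con 0ℚ)) := a :* c :+ a :* e)
                       refl (a l) (at c₀ (ρ r)) (at (unit (ρ l)) (ρ r)) (δ l) ⟩
          a l * at c₀ (ρ r) + a l * at (unit (ρ l)) (ρ r) ∎
        off-diagonal : ∀ l → l ≢ r → a l * at (unit (ρ l)) (ρ r) ≡ 0ℚ
        off-diagonal l l≢r = trans (cong (a l *_) (unit-off (ρ l) _ _ (l≢r ∘ sym ∘ punchIn²-injective p₀ r l)))
                                   (ℚ.*-zeroʳ (a l))

    -- Reading the combination at the coordinate ρ r gives a r = - (∑ a) c₀(ρ r); summing over r
    -- yields (∑ a)(1 + ∑ c₀(ρ r)) = 0, and c₀ ≥ 0 forces ∑ a = 0.
    v-independent : LinIndep v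
    v-independent a Σav≡0 r = begin-equality
      a r                               ≡⟨ solve 2 (λ s e → e := con 0ℚ :* s :+ e) refl (at c₀ (ρ r)) (a r) ⟩
      0ℚ * at c₀ (ρ r) + a r            ≡⟨ cong (λ s → s * at c₀ (ρ r) + a r) Σa≡0 ⟨
      sumFin m a * at c₀ (ρ r) + a r    ≡⟨ Σa[ρ]≡0 r ⟩
      0ℚ                                ∎
      where
      S = sumFin m a
      C = sumFin m (λ r → at c₀ (ρ r))
      Σa[ρ]≡0 : ∀ r → S * at c₀ (ρ r) + a r ≡ 0ℚ
      Σa[ρ]≡0 r = trans (sym (v[ρ] a r)) (Σav≡0 (proj₁ (ρ r)) (proj₂ (ρ r)))
      [1+C]S≡0 : (1ℚ + C) * S ≡ 0ℚ
      [1+C]S≡0 = begin-equality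
        (1ℚ + C) * S                               ≡⟨ solve 2 (λ s c → (con 1ℚ :+ c) :* s := s :* c :+ s) refl S C ⟩
        S * C + S                                  ≡⟨ cong₂ _+_ (sumFin-*ˡ m S _) refl ⟨
        sumFin m (λ r → S * at c₀ (ρ r)) + S       ≡⟨ sumFin-+ m _ _ ⟨
        sumFin m (λ r → S * at c₀ (ρ r) + a r)     ≡⟨ sumFin-cong m Σa[ρ]≡0 ⟩
        sumFin m (λ _ → 0ℚ)                        ≡⟨ sumFin-zero m ⟩
        0ℚ                                         ∎
      1+C≢0 : 1ℚ + C ≢ 0ℚ
      1+C≢0 1+C≡0 = 1≰0 (begin
        1ℚ       ≡⟨ ℚ.+-identityʳ 1ℚ ⟨
        1ℚ + 0ℚ  ≤⟨ ℚ.+-monoʳ-≤ 1ℚ (sumFin-nonNeg m _ (λ r → c₀≥0 (proj₁ (ρ r)) (proj₂ (ρ r)))) ⟩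
        1ℚ + C   ≡⟨ 1+C≡0 ⟩
        0ℚ       ∎)
      Σa≡0 : S ≡ 0ℚ
      Σa≡0 = p≢0⇒p*q≡0⇒q≡0 1+C≢0 [1+C]S≡0

    -- The common facet lies in the hyperplane ⟨ c , x ⟩ = ⟨ c , y ⟩, on which the coordinates
    -- other than p₀ determine c, since x and y differ at p₀.
    facet-dim≤ : ∀ (V : Fin (suc m) → Pt (suc n)) → (∀ l → Kmax (suc n) k x (V l) × Kmax (suc n) k y (V l)) →
      ¬ LinIndep V
    facet-dim≤ V V∈K V-independent with homogeneous-solvable m (λ r l → at (V l) (ρ r))
    ... | a , (l , aₗ≢0) , aV[ρ]≡0 = aₗ≢0 (V-independent a U≡0 l)
      where
      U : Pt (suc n)
      U i j = sumFin (suc m) (λ l → a l * V l i j)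
      U-off-p₀ : ∀ i j → (i , j) ≢ p₀ → U i j ≡ 0ℚ
      U-off-p₀ i j ij≢p₀ with punchIn²-surjective p₀ (i , j) ij≢p₀
      ... | r , refl = aV[ρ]≡0 r
      ⟨U⟩ : ∀ z → ⟨ U , z ⟩ ≡ at U p₀ * at z p₀
      ⟨U⟩ z = ⟨⟩-supported p₀ U z U-off-p₀
      ⟨V,x⟩≡⟨V,y⟩ : ∀ l → ⟨ V l , x ⟩ ≡ ⟨ V l , y ⟩
      ⟨V,x⟩≡⟨V,y⟩ l = ℚ.≤-antisym (proj₂ (proj₂ (V∈K l)) x x∈X) (proj₂ (proj₁ (V∈K l)) y y∈X)
      U[p₀]≡0 : at U p₀ ≡ 0ℚ
      U[p₀]≡0 = begin-equality
        at U p₀                                    ≡⟨ ℚ.*-identityʳ (at U p₀) ⟨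
        at U p₀ * 1ℚ                               ≡⟨ cong (at U p₀ *_) x[p₀]≡1 ⟨
        at U p₀ * at x p₀                          ≡⟨ ⟨U⟩ x ⟨
        ⟨ U , x ⟩                                  ≡⟨ ⟨⟩-linear (suc m) a V x ⟩
        sumFin (suc m) (λ l → a l * ⟨ V l , x ⟩)   ≡⟨ sumFin-cong (suc m) (λ l → cong (a l *_) (⟨V,x⟩≡⟨V,y⟩ l)) ⟩
        sumFin (suc m) (λ l → a l * ⟨ V l , y ⟩)   ≡⟨ ⟨⟩-linear (suc m) a V y ⟨
        ⟨ U , y ⟩                                  ≡⟨ ⟨U⟩ y ⟩
        at U p₀ * at y p₀                          ≡⟨ cong (at U p₀ *_) y[p₀]≡0 ⟩
        at U p₀ * 0ℚ                               ≡⟨ ℚ.*-zeroʳ (at U p₀) ⟩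
        0ℚ                                         ∎
      U≡0 : ∀ i j → U i j ≡ 0ℚ
      U≡0 i j with (i , j) ≟ᵢ p₀
      ... | yes ij≡p₀ = subst (λ q → at U q ≡ 0ℚ) (sym ij≡p₀) U[p₀]≡0
      ... | no  ij≢p₀ = U-off-p₀ i j ij≢p₀

    distinct-cones : ¬ SameCone (suc n) k x y
    distinct-cones same = 1≰0 (begin
      1ℚ                                  ≡⟨ solve 1 (λ b → con 1ℚ := (:- b) :+ (b :+ con 1ℚ)) refl B ⟩
      - B + (B + 1ℚ)                      ≡⟨ cong (λ e → - B + (B + e)) x[p₀]≡1 ⟨
      - B + (B + at x p₀)                 ≡⟨ cong (- B +_) (⟨c*⟩ x) ⟨
      - B + ⟨ c₀ ⊕ unit p₀ , x ⟩          ≤⟨ ℚ.+-monoʳ-≤ (- B) (proj₂ (Equivalence.to (same _) c*∈Kx) x x∈X) ⟩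
      - B + ⟨ c₀ ⊕ unit p₀ , y ⟩          ≡⟨ cong (- B +_) (trans (⟨c*⟩ y) (cong (_+ at y p₀) c₀-tie)) ⟩
      - B + (B + at y p₀)                 ≡⟨ cong (λ e → - B + (B + e)) y[p₀]≡0 ⟩
      - B + (B + 0ℚ)                      ≡⟨ solve 1 (λ b → (:- b) :+ (b :+ con 0ℚ) := con 0ℚ) refl B ⟩
      0ℚ                                  ∎)
      where
      ⟨c*⟩ : ∀ z → ⟨ c₀ ⊕ unit p₀ , z ⟩ ≡ ⟨ c₀ , z ⟩ + at z p₀
      ⟨c*⟩ z = trans (⟨⟩-distrib-⊕ c₀ (unit p₀) z) (cong (⟨ c₀ , z ⟩ +_) (⟨unit⟩ p₀ z))
      ⟨unit,z⟩≤ : ∀ z → InX (suc n) k z → ⟨ unit p₀ , z ⟩ ≤ 1ℚ + ⟨ unit p₀ , x ⟩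
      ⟨unit,z⟩≤ z z∈X = begin
        ⟨ unit p₀ , z ⟩       ≡⟨ ⟨unit⟩ p₀ z ⟩
        at z p₀               ≤⟨ bit≤1 (InX-bit z∈X p₀) ⟩
        1ℚ                    ≤⟨ ℚ.≤ᵇ⇒≤ _ ⟩
        1ℚ + 1ℚ               ≡⟨ cong (1ℚ +_) (trans (⟨unit⟩ p₀ x) x[p₀]≡1) ⟨
        1ℚ + ⟨ unit p₀ , x ⟩  ∎
      c*∈Kx : Kmax (suc n) k x (c₀ ⊕ unit p₀)
      c*∈Kx = perturbed-∈K {x} (unit p₀) refl (λ i j → ℚ.+-mono-≤ (c₀≥0 i j) (0≤unit p₀ i j)) ℚ.≤-refl
        (subst₂ _≤_ (sym (trans (⟨unit⟩ p₀ y) y[p₀]≡0)) (sym (trans (⟨unit⟩ p₀ x) x[p₀]≡1)) (ℚ.≤ᵇ⇒≤ _))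
        ⟨unit,z⟩≤

    facet-adjacent : Adjacent (suc n) k x y
    facet-adjacent = distinct-cones , (v , v∈K , v-independent) , facet-dim≤

open Facets

module Rectangles where

  open import Data.Nat.Base using (ℕ; zero; suc; z≤n; s≤s; _+_; _*_; _≤_; _<_)
  open import Data.Nat.Properties
  open import Data.Nat.Tactic.RingSolver using (solve-∀)
  import Data.Fin.Properties as Fin
  open import Data.Fin.Subset using (Subset; ∣_∣; _∈_; _∉_; _⊆_; inside; outside)
  open import Data.Fin.Subset.Properties using (_∈?_; drop-∷-⊆; drop-there; p⊆q⇒∣p∣≤∣q∣)
  open import Data.Vec.Base using ([]; _∷_; lookup; here; there)
  open import Data.Vec.Properties using ([]=⇒lookup; lookup⇒[]=)
  open import Data.Bool.Base using (true; false; _∧_; if_then_else_)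
  open import Data.Rational.Base as ℚ using (ℚ; 0ℚ; 1ℚ)
  import Data.Rational.Properties as ℚ
  import Algebra.Properties.Semiring.Sum +-*-semiring as ℕΣ

  fromℕ : ℕ → ℚ
  fromℕ zero    = 0ℚ
  fromℕ (suc a) = 1ℚ ℚ.+ fromℕ a

  fromℕ-+ : ∀ a b → fromℕ (a + b) ≡ fromℕ a ℚ.+ fromℕ b
  fromℕ-+ zero    b = sym (ℚ.+-identityˡ (fromℕ b))
  fromℕ-+ (suc a) b = trans (cong (1ℚ ℚ.+_) (fromℕ-+ a b)) (sym (ℚ.+-assoc 1ℚ (fromℕ a) (fromℕ b)))

  fromℕ-nonNeg : ∀ a → 0ℚ ℚ.≤ fromℕ a
  fromℕ-nonNeg zero    = ℚ.≤-refl
  fromℕ-nonNeg (suc a) = ℚ.+-mono-≤ {0ℚ} {1ℚ} (ℚ.≤ᵇ⇒≤ _) (fromℕ-nonNeg a)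

  fromℕ-mono-≤ : ∀ {a b} → a ≤ b → fromℕ a ℚ.≤ fromℕ b
  fromℕ-mono-≤ {b = b} z≤n = fromℕ-nonNeg b
  fromℕ-mono-≤ (s≤s a≤b)   = ℚ.+-monoʳ-≤ 1ℚ (fromℕ-mono-≤ a≤b)

  sumFin-fromℕ : ∀ m (f : Fin m → ℕ) → sumFin m (fromℕ ∘ f) ≡ fromℕ (ℕΣ.sum f)
  sumFin-fromℕ zero    f = refl
  sumFin-fromℕ (suc m) f = trans (cong (fromℕ (f zero) ℚ.+_) (sumFin-fromℕ m (f ∘ suc)))
                                 (sym (fromℕ-+ (f zero) (ℕΣ.sum (f ∘ suc))))

  ∑-mono-≤ : ∀ {m} {f g : Fin m → ℕ} → (∀ i → f i ≤ g i) → ℕΣ.sum f ≤ ℕΣ.sum g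
  ∑-mono-≤ {zero}  f≤g = z≤n
  ∑-mono-≤ {suc m} f≤g = +-mono-≤ (f≤g zero) (∑-mono-≤ (f≤g ∘ suc))

  ∑-mono-< : ∀ {m} {f g : Fin m → ℕ} → (∀ i → f i ≤ g i) → ∀ i → f i < g i → ℕΣ.sum f < ℕΣ.sum g
  ∑-mono-< f≤g zero    f<g = +-mono-<-≤ f<g (∑-mono-≤ (f≤g ∘ suc))
  ∑-mono-< f≤g (suc i) f<g = +-mono-≤-< (f≤g zero) (∑-mono-< (f≤g ∘ suc) i f<g)

  Weight : ℕ → ℕ → Set
  Weight m n = Fin m → Fin n → ℕ

  ∑∑ : ∀ {m n} → Weight m n → ℕ
  ∑∑ f = ℕΣ.sum (λ i → ℕΣ.sum (f i))

  ∑∑-cong : ∀ {m n} {f g : Weight m n} → (∀ i j → f i j ≡ g i j) → ∑∑ f ≡ ∑∑ g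
  ∑∑-cong f≗g = ℕΣ.sum-cong-≗ λ i → ℕΣ.sum-cong-≗ (f≗g i)

  ∑∑-linear : ∀ {m n} a (f g : Weight m n) → ∑∑ (λ i j → a * f i j + g i j) ≡ a * ∑∑ f + ∑∑ g
  ∑∑-linear a f g = trans (ℕΣ.sum-cong-≗ λ i → linear (f i) (g i)) (linear (λ i → ℕΣ.sum (f i)) (λ i → ℕΣ.sum (g i)))
    where
    linear : ∀ {m} (u v : Fin m → ℕ) → ℕΣ.sum (λ i → a * u i + v i) ≡ a * ℕΣ.sum u + ℕΣ.sum v
    linear u v = trans (ℕΣ.∑-distrib-+ (λ i → a * u i) v) (cong (_+ ℕΣ.sum v) (sym (ℕΣ.*-distribˡ-sum a u)))

  ∑∑-mono-≤ : ∀ {m n} {f g : Weight m n} → (∀ i j → f i j ≤ g i j) → ∑∑ f ≤ ∑∑ g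
  ∑∑-mono-≤ f≤g = ∑-mono-≤ λ i → ∑-mono-≤ (f≤g i)

  ∑∑-mono-< : ∀ {m n} {f g : Weight m n} → (∀ i j → f i j ≤ g i j) → ∀ i j → f i j < g i j → ∑∑ f < ∑∑ g
  ∑∑-mono-< f≤g i j f<g = ∑-mono-< (λ i → ∑-mono-≤ (f≤g i)) i (∑-mono-< (f≤g i) j f<g)

  mask : ∀ {m n} → Subset m → Subset n → Weight m n → Weight m n
  mask C D g i j = if lookup C i ∧ lookup D j then g i j else 0

  W : ∀ {m n} → Weight m n → Subset m → Subset n → ℕ
  W g C D = ∑∑ (mask C D g)

  ⟨fromℕ,χ⟩ : ∀ {n} (g : Weight n n) C D → ⟨ (λ i j → fromℕ (g i j)) , χ (C , D) ⟩ ≡ fromℕ (W g C D)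
  ⟨fromℕ,χ⟩ {n} g C D = trans (sumFin-cong n λ i → trans (sumFin-cong n λ j → entry (lookup C i ∧ lookup D j))
                                                          (sumFin-fromℕ n _))
                               (sumFin-fromℕ n _)
    where
    entry : ∀ {a} b → fromℕ a ℚ.* (if b then 1ℚ else 0ℚ) ≡ fromℕ (if b then a else 0)
    entry {a} true  = ℚ.*-identityʳ (fromℕ a)
    entry {a} false = ℚ.*-zeroʳ (fromℕ a)

  W-linear : ∀ {m n} a (g h : Weight m n) C D → W (λ i j → a * g i j + h i j) C D ≡ a * W g C D + W h C D
  W-linear a g h C D = trans (∑∑-cong λ i j → entry (lookup C i ∧ lookup D j)) (∑∑-linear a (mask C D g) (mask C D h))
    where
    entry : ∀ {x y} b → (if b then a * x + y else 0) ≡ a * (if b then x else 0) + (if b then y else 0)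
    entry true  = refl
    entry false = cong (_+ 0) (sym (*-zeroʳ a))

  mask-mono-≤ : ∀ {m n} {g h : Weight m n} → (∀ i j → g i j ≤ h i j) → ∀ C D i j → mask C D g i j ≤ mask C D h i j
  mask-mono-≤ g≤h C D i j with lookup C i ∧ lookup D j
  ... | true  = g≤h i j
  ... | false = z≤n

  W-mono-≤ : ∀ {m n} {g h : Weight m n} → (∀ i j → g i j ≤ h i j) → ∀ C D → W g C D ≤ W h C D
  W-mono-≤ g≤h C D = ∑∑-mono-≤ (mask-mono-≤ g≤h C D)

  W-mono-< : ∀ {m n} {g h : Weight m n} → (∀ i j → g i j ≤ h i j) → ∀ {C D i j} → i ∈ C → j ∈ D →
    g i j < h i j → W g C D < W h C D
  W-mono-< g≤h {C} {D} {i} {j} i∈C j∈D g<h = ∑∑-mono-< (mask-mono-≤ g≤h C D) i j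
    (subst (λ b → (if b then _ else 0) < (if b then _ else 0)) (sym (cong₂ _∧_ ([]=⇒lookup i∈C) ([]=⇒lookup j∈D))) g<h)

  W-cong : ∀ {m n} {g h : Weight m n} {C D} → (∀ {i j} → i ∈ C → j ∈ D → g i j ≡ h i j) → W g C D ≡ W h C D
  W-cong {g = g} {h} {C} {D} g≡h = ∑∑-cong entry
    where
    entry : ∀ i j → mask C D g i j ≡ mask C D h i j
    entry i j with lookup C i in C[i] | lookup D j in D[j]
    ... | true  | true  = g≡h (lookup⇒[]= i C C[i]) (lookup⇒[]= j D D[j])
    ... | true  | false = refl
    ... | false | _     = refl

  ∑-count : ∀ {m} (C : Subset m) a → ℕΣ.sum (λ i → if lookup C i then a else 0) ≡ ∣ C ∣ * a
  ∑-count []          a = refl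
  ∑-count (true  ∷ C) a = cong (a +_) (∑-count C a)
  ∑-count (false ∷ C) a = ∑-count C a

  if-0 : ∀ b → (if b then 0 else 0) ≡ 0
  if-0 true  = refl
  if-0 false = refl

  W-one : ∀ {m n} (C : Subset m) (D : Subset n) → W (λ _ _ → 1) C D ≡ ∣ C ∣ * ∣ D ∣
  W-one {n = n} C D = trans (ℕΣ.sum-cong-≗ λ i → row (lookup C i)) (∑-count C ∣ D ∣)
    where
    row : ∀ b → ℕΣ.sum (λ j → if b ∧ lookup D j then 1 else 0) ≡ (if b then ∣ D ∣ else 0)
    row true  = trans (∑-count D 1) (*-identityʳ ∣ D ∣)
    row false = ℕΣ.sum-replicate-zero n

  W-zero : ∀ {m n} (C : Subset m) (D : Subset n) → W (λ _ _ → 0) C D ≡ 0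
  W-zero {m} {n} C D = trans (∑∑-cong λ i j → if-0 (lookup C i ∧ lookup D j))
                             (trans (ℕΣ.sum-cong-≗ {m} λ _ → ℕΣ.sum-replicate-zero n) (ℕΣ.sum-replicate-zero m))

  nonzero : ∀ {m} → Fin m → ℕ
  nonzero zero    = 0
  nonzero (suc _) = 1

  nonzero≤1 : ∀ {m} (i : Fin m) → nonzero i ≤ 1
  nonzero≤1 zero    = z≤n
  nonzero≤1 (suc _) = ≤-refl

  W-nonzero : ∀ {m n} c (C : Subset m) (D : Subset n) → W (λ i _ → nonzero i) (c ∷ C) D ≡ ∣ C ∣ * ∣ D ∣
  W-nonzero {n = n} c C D =
    cong₂ _+_ (trans (ℕΣ.sum-cong-≗ λ j → if-0 (c ∧ lookup D j)) (ℕΣ.sum-replicate-zero n)) (W-one C D)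

  χ-inside : ∀ {n} {C D : Subset n} {i j} → i ∈ C → j ∈ D → χ (C , D) i j ≡ 1ℚ
  χ-inside i∈C j∈D rewrite []=⇒lookup i∈C | []=⇒lookup j∈D = refl

  χ-outside : ∀ {n} {C : Subset n} {i} → i ∉ C → ∀ D j → χ (C , D) i j ≡ 0ℚ
  χ-outside {C = C} {i} i∉C D j with lookup C i in C[i]
  ... | true  = contradiction (lookup⇒[]= i C C[i]) i∉C
  ... | false = refl

  weighted-witness : ∀ {n k P Q P′ Q′} (i₀ j₀ : Fin n) →
    χ (P , Q) i₀ j₀ ≡ 1ℚ → χ (P′ , Q′) i₀ j₀ ≡ 0ℚ →
    (g : Weight n n) → 1 ≤ g i₀ j₀ → W g P′ Q′ ≡ W g P Q →
    (∀ C D → Admissible k (C , D) → ((C , D) ≡ (P , Q) ⊎ (C , D) ≡ (P′ , Q′)) ⊎ W g C D < W g P Q) →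
    FacetWitness n k (χ (P , Q)) (χ (P′ , Q′))
  weighted-witness {P = P} {Q} {P′} {Q′} i₀ j₀ x₀≡1 y₀≡0 g 1≤g tie gap = record
    { p₀       = i₀ , j₀
    ; x[p₀]≡1  = x₀≡1
    ; y[p₀]≡0  = y₀≡0
    ; c₀       = c₀
    ; c₀≥0     = λ i j → fromℕ-nonNeg (g i j)
    ; c₀[p₀]≥1 = fromℕ-mono-≤ 1≤g
    ; c₀-tie   = trans (⟨fromℕ,χ⟩ g P′ Q′) (trans (cong fromℕ tie) (sym (⟨fromℕ,χ⟩ g P Q)))
    ; c₀-gap   = λ { z ((C , D) , adm , refl) → lift (gap C D adm) }
    }
    where
    c₀ : Pt _
    c₀ i j = fromℕ (g i j)
    lift : ∀ {C D} → ((C , D) ≡ (P , Q) ⊎ (C , D) ≡ (P′ , Q′)) ⊎ W g C D < W g P Q →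
      χ (C , D) ≡ χ (P , Q) ⊎ χ (C , D) ≡ χ (P′ , Q′) ⊎ ⟨ c₀ , χ (C , D) ⟩ ℚ.+ 1ℚ ℚ.≤ ⟨ c₀ , χ (P , Q) ⟩
    lift (inj₁ (inj₁ eq)) = inj₁ (cong χ eq)
    lift (inj₁ (inj₂ eq)) = inj₂ (inj₁ (cong χ eq))
    lift {C} {D} (inj₂ lt) = inj₂ (inj₂ (subst₂ ℚ._≤_
      (trans (ℚ.+-comm 1ℚ (fromℕ (W g C D))) (cong (ℚ._+ 1ℚ) (sym (⟨fromℕ,χ⟩ g C D))))
      (sym (⟨fromℕ,χ⟩ g P Q))
      (fromℕ-mono-≤ lt)))

  ⊆-or-witness : ∀ {n} (C P : Subset n) → C ⊆ P ⊎ ∃ λ i → i ∈ C × i ∉ P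
  ⊆-or-witness C P with Fin.any? (λ i → i ∈? C ×-dec ¬? (i ∈? P))
  ... | yes witness = inj₂ witness
  ... | no  ¬witness = inj₁ λ {i} i∈C → decidable-stable (i ∈? P) (λ i∉P → ¬witness (i , i∈C , i∉P))

  ⊆∧∣⊇∣⇒≡ : ∀ {n} {C P : Subset n} → C ⊆ P → ∣ P ∣ ≤ ∣ C ∣ → C ≡ P
  ⊆∧∣⊇∣⇒≡ {C = []}          {[]}          _   _         = refl
  ⊆∧∣⊇∣⇒≡ {C = inside  ∷ C} {inside  ∷ P} C⊆P (s≤s ∣P∣≤∣C∣) = cong (inside ∷_) (⊆∧∣⊇∣⇒≡ (drop-∷-⊆ C⊆P) ∣P∣≤∣C∣)
  ⊆∧∣⊇∣⇒≡ {C = inside  ∷ C} {outside ∷ P} C⊆P _           = contradiction (C⊆P here) λ ()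
  ⊆∧∣⊇∣⇒≡ {C = outside ∷ C} {inside  ∷ P} C⊆P ∣P∣<∣C∣     =
    contradiction ∣P∣<∣C∣ (<⇒≱ (s≤s (p⊆q⇒∣p∣≤∣q∣ (drop-∷-⊆ C⊆P))))
  ⊆∧∣⊇∣⇒≡ {C = outside ∷ C} {outside ∷ P} C⊆P ∣P∣≤∣C∣     = cong (outside ∷_) (⊆∧∣⊇∣⇒≡ (drop-∷-⊆ C⊆P) ∣P∣≤∣C∣)

  ∣<∣⇒∃∉ : ∀ {n} {C P : Subset n} → ∣ P ∣ < ∣ C ∣ → ∃ λ i → i ∈ C × i ∉ P
  ∣<∣⇒∃∉ {C = C} {P} ∣P∣<∣C∣ with ⊆-or-witness C P
  ... | inj₁ C⊆P    = contradiction (p⊆q⇒∣p∣≤∣q∣ C⊆P) (<⇒≱ ∣P∣<∣C∣)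
  ... | inj₂ witness = witness

  ∣≡∣∧≢⇒∃∉ : ∀ {n} {C P : Subset n} → ∣ C ∣ ≡ ∣ P ∣ → C ≢ P → ∃ λ i → i ∈ C × i ∉ P
  ∣≡∣∧≢⇒∃∉ {C = C} {P} ∣C∣≡∣P∣ C≢P with ⊆-or-witness C P
  ... | inj₁ C⊆P    = contradiction (⊆∧∣⊇∣⇒≡ C⊆P (≤-reflexive (sym ∣C∣≡∣P∣))) C≢P
  ... | inj₂ witness = witness

  Inside : ∀ {m n} → (Fin m → Fin n → Set) → Subset m → Subset n → Set
  Inside R C D = ∀ {i j} → i ∈ C → j ∈ D → R i j

  inside-or-witness : ∀ {m n} {R : Fin m → Fin n → Set} → (∀ i j → Dec (R i j)) → ∀ C D →
    Inside R C D ⊎ ∃₂ λ i j → i ∈ C × j ∈ D × ¬ R i j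
  inside-or-witness R? C D with Fin.any? (λ i → i ∈? C ×-dec Fin.any? (λ j → j ∈? D ×-dec ¬? (R? i j)))
  ... | yes (i , i∈C , j , j∈D , ¬Rij) = inj₂ (i , j , i∈C , j∈D , ¬Rij)
  ... | no  ¬witness = inj₁ λ {i} {j} i∈C j∈D →
    decidable-stable (R? i j) (λ ¬Rij → ¬witness (i , i∈C , j , j∈D , ¬Rij))

  𝟙 : ∀ {a} {A : Set a} → Dec A → ℕ
  𝟙 (yes _) = 1
  𝟙 (no  _) = 0

  𝟙≤1 : ∀ {a} {A : Set a} (d : Dec A) → 𝟙 d ≤ 1
  𝟙≤1 (yes _) = ≤-refl
  𝟙≤1 (no  _) = z≤n

  𝟙-yes : ∀ {a} {A : Set a} → A → (d : Dec A) → 𝟙 d ≡ 1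
  𝟙-yes _ (yes _) = refl
  𝟙-yes a (no ¬a) = contradiction a ¬a

  𝟙-no : ∀ {a} {A : Set a} → ¬ A → (d : Dec A) → 𝟙 d ≡ 0
  𝟙-no ¬a (yes a) = contradiction a ¬a
  𝟙-no _  (no _)  = refl

  module _ {m n} {R : Fin m → Fin n → Set} (R? : ∀ i j → Dec (R i j)) where

    W-𝟙-inside : ∀ {C D} → Inside R C D → W (λ i j → 𝟙 (R? i j)) C D ≡ ∣ C ∣ * ∣ D ∣
    W-𝟙-inside {C} {D} C⊠D⊆R = trans (W-cong λ i∈C j∈D → 𝟙-yes (C⊠D⊆R i∈C j∈D) (R? _ _)) (W-one C D)

    W-𝟙-outside : ∀ {C D i j} → i ∈ C → j ∈ D → ¬ R i j → W (λ i j → 𝟙 (R? i j)) C D < ∣ C ∣ * ∣ D ∣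
    W-𝟙-outside {C} {D} {i} {j} i∈C j∈D ¬Rij = subst (W (λ i j → 𝟙 (R? i j)) C D <_) (W-one C D)
      (W-mono-< (λ i j → 𝟙≤1 (R? i j)) i∈C j∈D (subst (_< 1) (sym (𝟙-no ¬Rij (R? i j))) 0<1+n))

  module Lexicographic {n} {R : Fin n → Fin n → Set} (R? : ∀ i j → Dec (R i j))
                       (h : Weight n n) (h≤1 : ∀ i j → h i j ≤ 1) (P Q : Subset n) where

    open ≤-Reasoning

    M : ℕ
    M = ∣ P ∣ * ∣ Q ∣

    -- Coverage by R counts with weight M + 1, which dominates any possible total of the tie-breaker h.
    lex : Weight n n
    lex i j = suc M * 𝟙 (R? i j) + h i j

    1≤lex : ∀ {i j} → R i j → 1 ≤ lex i j
    1≤lex {i} {j} Rij rewrite 𝟙-yes Rij (R? i j) = ≤-trans (s≤s z≤n) (m≤m+n (suc M * 1) (h i j))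

    W-lex-inside : ∀ {C D} → Inside R C D → W lex C D ≡ suc M * (∣ C ∣ * ∣ D ∣) + W h C D
    W-lex-inside {C} {D} C⊠D⊆R = trans (W-linear (suc M) (λ i j → 𝟙 (R? i j)) h C D)
                                       (cong (λ w → suc M * w + W h C D) (W-𝟙-inside R? C⊠D⊆R))

    W-lex-below : Inside R P Q → ∀ C D → W (λ i j → 𝟙 (R? i j)) C D < M → ∣ C ∣ * ∣ D ∣ ≤ M →
      W lex C D < W lex P Q
    W-lex-below P⊠Q⊆R C D w<M size≤M = begin-strict
      W lex C D            ≡⟨ W-linear (suc M) (λ i j → 𝟙 (R? i j)) h C D ⟩
      suc M * w + W h C D  ≤⟨ +-monoʳ-≤ (suc M * w) h≤M ⟩
      suc M * w + M        <⟨ +-monoʳ-< (suc M * w) (n<1+n M) ⟩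
      suc M * w + suc M    ≡⟨ +-comm (suc M * w) (suc M) ⟩
      suc M + suc M * w    ≡⟨ *-suc (suc M) w ⟨
      suc M * suc w        ≤⟨ *-monoʳ-≤ (suc M) w<M ⟩
      suc M * M            ≤⟨ m≤m+n (suc M * M) (W h P Q) ⟩
      suc M * M + W h P Q  ≡⟨ W-lex-inside P⊠Q⊆R ⟨
      W lex P Q            ∎
      where
      w = W (λ i j → 𝟙 (R? i j)) C D
      h≤M : W h C D ≤ M
      h≤M = ≤-trans (W-mono-≤ h≤1 C D) (≤-trans (≤-reflexive (W-one C D)) size≤M)

    lex-gap : ∀ {k} (E : Subset n → Subset n → Set) → Inside R P Q →
      (∀ C D → Admissible k (C , D) → ∣ C ∣ * ∣ D ∣ ≤ M) →
      (∀ C D → Admissible k (C , D) → Inside R C D → ∣ C ∣ * ∣ D ∣ ≡ M → E C D ⊎ W h C D < W h P Q) →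
      ∀ C D → Admissible k (C , D) → E C D ⊎ W lex C D < W lex P Q
    lex-gap E P⊠Q⊆R size≤M tie C D adm with inside-or-witness R? C D | m≤n⇒m<n∨m≡n (size≤M C D adm)
    ... | inj₂ (i , j , i∈C , j∈D , ¬Rij) | _ =
      inj₂ (W-lex-below P⊠Q⊆R C D (<-≤-trans (W-𝟙-outside R? i∈C j∈D ¬Rij) (size≤M C D adm)) (size≤M C D adm))
    ... | inj₁ C⊠D⊆R | inj₁ size<M =
      inj₂ (W-lex-below P⊠Q⊆R C D (subst (_< M) (sym (W-𝟙-inside R? C⊠D⊆R)) size<M) (size≤M C D adm))
    ... | inj₁ C⊠D⊆R | inj₂ size≡M with tie C D adm C⊠D⊆R size≡M
    ...   | inj₁ e      = inj₁ e
    ...   | inj₂ Wh<WhP = inj₂ (begin-strict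
      W lex C D                          ≡⟨ W-lex-inside C⊠D⊆R ⟩
      suc M * (∣ C ∣ * ∣ D ∣) + W h C D  ≡⟨ cong (λ s → suc M * s + W h C D) size≡M ⟩
      suc M * M + W h C D                <⟨ +-monoʳ-< (suc M * M) Wh<WhP ⟩
      suc M * M + W h P Q                ≡⟨ W-lex-inside P⊠Q⊆R ⟨
      W lex P Q                          ∎)

  TwoRectangles : ∀ {n} → Subset n → Subset n → Subset n → Subset n → Fin n → Fin n → Set
  TwoRectangles P Q P′ Q′ i j = (i ∈ P × j ∈ Q) ⊎ (i ∈ P′ × j ∈ Q′)

  two-rectangles? : ∀ {n} (P Q P′ Q′ : Subset n) i j → Dec (TwoRectangles P Q P′ Q′ i j)
  two-rectangles? P Q P′ Q′ i j = (i ∈? P ×-dec j ∈? Q) ⊎-dec (i ∈? P′ ×-dec j ∈? Q′)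

  module _ {n} {P Q P′ Q′ C D : Subset n} (C⊠D⊆R : Inside (TwoRectangles P Q P′ Q′) C D) where

    column-outside-second : ∀ {j} → j ∈ D → j ∉ Q′ → C ⊆ P
    column-outside-second j∈D j∉Q′ i∈C with C⊠D⊆R i∈C j∈D
    ... | inj₁ (i∈P , _)  = i∈P
    ... | inj₂ (_ , j∈Q′) = contradiction j∈Q′ j∉Q′

    row-outside-second : ∀ {i} → i ∈ C → i ∉ P′ → D ⊆ Q
    row-outside-second i∈C i∉P′ j∈D with C⊠D⊆R i∈C j∈D
    ... | inj₁ (_ , j∈Q)  = j∈Q
    ... | inj₂ (i∈P′ , _) = contradiction i∈P′ i∉P′

    column-outside-first : ∀ {j} → j ∈ D → j ∉ Q → C ⊆ P′
    column-outside-first j∈D j∉Q i∈C with C⊠D⊆R i∈C j∈D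
    ... | inj₁ (_ , j∈Q)  = contradiction j∈Q j∉Q
    ... | inj₂ (i∈P′ , _) = i∈P′

    rectangle-in-two : ∀ {i₀ j₀} → i₀ ∈ P → i₀ ∉ P′ → j₀ ∈ Q′ → j₀ ∉ Q →
      ∣ P ∣ ≤ ∣ C ∣ → ∣ Q ∣ ≤ ∣ D ∣ → ∣ P′ ∣ ≤ ∣ C ∣ → ∣ Q′ ∣ ≤ ∣ D ∣ →
      (C , D) ≡ (P , Q) ⊎ (C , D) ≡ (P′ , Q′)
    rectangle-in-two {i₀} {j₀} i₀∈P i₀∉P′ j₀∈Q′ j₀∉Q ∣P∣≤ ∣Q∣≤ ∣P′∣≤ ∣Q′∣≤ with ⊆-or-witness D Q′
    ... | inj₁ D⊆Q′ = inj₂ (cong₂ _,_ C≡P′ D≡Q′)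
      where
      D≡Q′ = ⊆∧∣⊇∣⇒≡ D⊆Q′ ∣Q′∣≤
      C≡P′ = ⊆∧∣⊇∣⇒≡ (column-outside-first (subst (j₀ ∈_) (sym D≡Q′) j₀∈Q′) j₀∉Q) ∣P′∣≤
    ... | inj₂ (j , j∈D , j∉Q′) = inj₁ (cong₂ _,_ C≡P D≡Q)
      where
      C≡P = ⊆∧∣⊇∣⇒≡ (column-outside-second j∈D j∉Q′) ∣P∣≤
      D≡Q = ⊆∧∣⊇∣⇒≡ (row-outside-second (subst (i₀ ∈_) (sym C≡P) i₀∈P) i₀∉P′) ∣Q∣≤

  product-deficit : ∀ p d t → p * (d + (p + d + t)) + d * (d + t) ≡ (p + d) * (p + d + t)
  product-deficit = solve-∀

  -- With s = p + d and r = s + t the constraint forces q = s + d + t, so p q = s r - d (d + t).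
  below-half : ∀ {p q s r} → p ≤ s → s ≤ r → p + q ≡ s + r → p * q ≤ s * r × (p * q ≡ s * r → p ≡ s)
  below-half {p} {q} p≤s s≤r p+q≡ with m≤n⇒∃[o]m+o≡n p≤s | m≤n⇒∃[o]m+o≡n s≤r
  ... | d , refl | t , refl = ≤-trans (m≤m+n (p * q) (d * (d + t))) (≤-reflexive deficit)
                            , λ pq≡ → sym (no-deficit pq≡)
    where
    q≡ : q ≡ d + (p + d + t)
    q≡ = +-cancelˡ-≡ p q _ (trans p+q≡ (+-assoc p d (p + d + t)))
    deficit : p * q + d * (d + t) ≡ (p + d) * (p + d + t)
    deficit = trans (cong (λ q → p * q + d * (d + t)) q≡) (product-deficit p d t)
    no-deficit : p * q ≡ (p + d) * (p + d + t) → p + d ≡ p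
    no-deficit pq≡
      with m*n≡0⇒m≡0∨n≡0 d (+-cancelˡ-≡ (p * q) _ 0 (trans deficit (trans (sym pq≡) (sym (+-identityʳ _)))))
    ... | inj₁ d≡0   = trans (cong (p +_) d≡0) (+-identityʳ p)
    ... | inj₂ d+t≡0 = trans (cong (p +_) (m+n≡0⇒m≡0 d d+t≡0)) (+-identityʳ p)

  one-below : ∀ {p q s r} → r ≤ suc s → p + q ≡ s + r → p ≤ s ⊎ q ≤ s
  one-below {p} {q} {s} {r} r≤1+s p+q≡ with p ≤? s
  ... | yes p≤s = inj₁ p≤s
  ... | no  p≰s = inj₂ (+-cancelˡ-≤ (suc s) q s (begin
    suc s + q   ≤⟨ +-monoˡ-≤ q (≰⇒> p≰s) ⟩
    p + q       ≡⟨ p+q≡ ⟩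
    s + r       ≤⟨ +-monoʳ-≤ s r≤1+s ⟩
    s + suc s   ≡⟨ +-suc s s ⟩
    suc s + s   ∎))
    where open ≤-Reasoning

  balanced-product : ∀ {p q s r} → s ≤ r → r ≤ suc s → p + q ≡ s + r →
    p * q ≤ s * r × (p * q ≡ s * r → (p ≡ s × q ≡ r) ⊎ (p ≡ r × q ≡ s))
  balanced-product {p} {q} {s} {r} s≤r r≤1+s p+q≡ with one-below r≤1+s p+q≡
  ... | inj₁ p≤s = proj₁ half , λ pq≡ → let p≡s = proj₂ half pq≡ in inj₁ (p≡s , cancel p≡s)
    where
    half = below-half p≤s s≤r p+q≡
    cancel : p ≡ s → q ≡ r
    cancel refl = +-cancelˡ-≡ s _ _ p+q≡
  ... | inj₂ q≤s = subst (_≤ s * r) (*-comm q p) (proj₁ half)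
                 , λ pq≡ → let q≡s = proj₂ half (trans (*-comm q p) pq≡) in inj₂ (cancel q≡s , q≡s)
    where
    q+p≡ = trans (+-comm q p) p+q≡
    half = below-half q≤s s≤r q+p≡
    cancel : q ≡ s → p ≡ r
    cancel refl = +-cancelˡ-≡ s _ _ q+p≡

  2s≡s+s : ∀ s → 2 * s ≡ s + s
  2s≡s+s s = cong (s +_) (+-identityʳ s)

  square∈X : ∀ {n s} {C : Subset n} → ∣ C ∣ ≡ s → InX n (2 * s) (χ (C , C))
  square∈X {s = s} {C} ∣C∣≡s = (C , C) , trans (cong₂ _+_ ∣C∣≡s ∣C∣≡s) (sym (2s≡s+s s)) , refl

  even-adjacent : ∀ {n s} {A B : Subset (suc n)} → ∣ A ∣ ≡ s → ∣ B ∣ ≡ s → A ≢ B →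
    Adjacent (suc n) (2 * s) (χ (A , A)) (χ (B , B))
  even-adjacent {n} {s} {A} {B} ∣A∣≡s ∣B∣≡s A≢B
    with ∣≡∣∧≢⇒∃∉ (trans ∣A∣≡s (sym ∣B∣≡s)) A≢B | ∣≡∣∧≢⇒∃∉ (trans ∣B∣≡s (sym ∣A∣≡s)) (A≢B ∘ sym)
  ... | a , a∈A , a∉B | b , b∈B , b∉A =
    facet-adjacent (square∈X {C = A} ∣A∣≡s) (square∈X {C = B} ∣B∣≡s)
      (weighted-witness a a (χ-inside a∈A a∈A) (χ-outside a∉B B a) lex (1≤lex (inj₁ (a∈A , a∈A))) tie
                        (lex-gap _ (λ i∈A j∈A → inj₁ (i∈A , j∈A)) size≤M classify))
    where
    open Lexicographic (two-rectangles? A A B B) (λ _ _ → 0) (λ _ _ → z≤n) A A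

    M≡s*s : M ≡ s * s
    M≡s*s = cong₂ _*_ ∣A∣≡s ∣A∣≡s

    products : ∀ C D → Admissible (2 * s) (C , D) →
      ∣ C ∣ * ∣ D ∣ ≤ s * s × (∣ C ∣ * ∣ D ∣ ≡ s * s → ∣ C ∣ ≡ s × ∣ D ∣ ≡ s)
    products C D adm with balanced-product ≤-refl (n≤1+n s) (trans adm (2s≡s+s s))
    ... | bound , extremal = bound , [ id , id ]′ ∘ extremal

    size≤M : ∀ C D → Admissible (2 * s) (C , D) → ∣ C ∣ * ∣ D ∣ ≤ M
    size≤M C D adm = subst (∣ C ∣ * ∣ D ∣ ≤_) (sym M≡s*s) (proj₁ (products C D adm))

    classify : ∀ C D → Admissible (2 * s) (C , D) → Inside (TwoRectangles A A B B) C D → ∣ C ∣ * ∣ D ∣ ≡ M →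
      ((C , D) ≡ (A , A) ⊎ (C , D) ≡ (B , B)) ⊎ W (λ _ _ → 0) C D < W (λ _ _ → 0) A A
    classify C D adm C⊠D⊆R size≡M with proj₂ (products C D adm) (trans size≡M M≡s*s)
    ... | ∣C∣≡s , ∣D∣≡s = inj₁ (rectangle-in-two C⊠D⊆R a∈A a∉B b∈B b∉A
      (≤-reflexive (trans ∣A∣≡s (sym ∣C∣≡s))) (≤-reflexive (trans ∣A∣≡s (sym ∣D∣≡s)))
      (≤-reflexive (trans ∣B∣≡s (sym ∣C∣≡s))) (≤-reflexive (trans ∣B∣≡s (sym ∣D∣≡s))))

    tie : W lex B B ≡ W lex A A
    tie = begin
      W lex B B                                       ≡⟨ W-lex-inside (λ i∈B j∈B → inj₂ (i∈B , j∈B)) ⟩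
      suc M * (∣ B ∣ * ∣ B ∣) + W (λ _ _ → 0) B B     ≡⟨ cong₂ (λ t w → suc M * t + w) (sizes {B} ∣B∣≡s) (W-zero B B) ⟩
      suc M * (s * s) + 0                             ≡⟨ cong₂ (λ t w → suc M * t + w) (sizes {A} ∣A∣≡s) (W-zero A A) ⟨
      suc M * (∣ A ∣ * ∣ A ∣) + W (λ _ _ → 0) A A     ≡⟨ W-lex-inside (λ i∈A j∈A → inj₁ (i∈A , j∈A)) ⟨
      W lex A A                                       ∎
      where
      open ≡-Reasoning
      sizes : ∀ {C : Subset (suc n)} → ∣ C ∣ ≡ s → ∣ C ∣ * ∣ C ∣ ≡ s * s
      sizes ∣C∣≡s = cong₂ _*_ ∣C∣≡s ∣C∣≡s

  2s+1≡s+[1+s] : ∀ s → 2 * s + 1 ≡ s + suc s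
  2s+1≡s+[1+s] = solve-∀

  flag∈X : ∀ {n s} {C : Subset n} → ∣ C ∣ ≡ s → InX (suc n) (2 * s + 1) (χ (inside ∷ C , outside ∷ C))
  flag∈X {s = s} {C} ∣C∣≡s =
    (inside ∷ C , outside ∷ C) , trans (cong (λ t → suc t + t) ∣C∣≡s) (sym (trans (2s+1≡s+[1+s] s) (+-suc s s))) , refl

  square-deficit : ∀ c → suc (c * suc (suc c)) ≡ suc c * suc c
  square-deficit = solve-∀

  odd-adjacent : ∀ {n s} {A B : Subset n} → ∣ A ∣ ≡ s → ∣ B ∣ ≡ s → A ≢ B →
    Adjacent (suc n) (2 * s + 1) (χ (inside ∷ A , outside ∷ A)) (χ (inside ∷ B , outside ∷ B))
  odd-adjacent {n} {s} {A} {B} ∣A∣≡s ∣B∣≡s A≢B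
    with ∣≡∣∧≢⇒∃∉ (trans ∣A∣≡s (sym ∣B∣≡s)) A≢B | ∣≡∣∧≢⇒∃∉ (trans ∣B∣≡s (sym ∣A∣≡s)) (A≢B ∘ sym)
  ... | a , a∈A , a∉B | b , b∈B , b∉A =
    facet-adjacent (flag∈X {C = A} ∣A∣≡s) (flag∈X {C = B} ∣B∣≡s)
      (weighted-witness (suc a) (suc a) (χ-inside a∈P a∈Q) (χ-outside a∉P′ Q′ (suc a))
                        lex (1≤lex (inj₁ (a∈P , a∈Q))) tie
                        (lex-gap _ (λ i∈P j∈Q → inj₁ (i∈P , j∈Q)) size≤M classify))
    where
    P Q P′ Q′ : Subset (suc n)
    P  = inside ∷ A
    Q  = outside ∷ A
    P′ = inside ∷ B
    Q′ = outside ∷ B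
    a∈P : suc a ∈ P
    a∈P = there a∈A
    a∈Q : suc a ∈ Q
    a∈Q = there a∈A
    a∉P′ : suc a ∉ P′
    a∉P′ = a∉B ∘ drop-there
    b∈Q′ : suc b ∈ Q′
    b∈Q′ = there b∈B
    b∉Q : suc b ∉ Q
    b∉Q = b∉A ∘ drop-there
    open Lexicographic (two-rectangles? P Q P′ Q′) (λ i _ → nonzero i) (λ i _ → nonzero≤1 i) P Q

    M≡s*[1+s] : M ≡ s * suc s
    M≡s*[1+s] = trans (cong (λ t → suc t * t) ∣A∣≡s) (*-comm (suc s) s)

    products : ∀ C D → Admissible (2 * s + 1) (C , D) → ∣ C ∣ * ∣ D ∣ ≤ s * suc s ×
      (∣ C ∣ * ∣ D ∣ ≡ s * suc s → (∣ C ∣ ≡ s × ∣ D ∣ ≡ suc s) ⊎ (∣ C ∣ ≡ suc s × ∣ D ∣ ≡ s))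
    products C D adm = balanced-product (n≤1+n s) ≤-refl (trans adm (2s+1≡s+[1+s] s))

    size≤M : ∀ C D → Admissible (2 * s + 1) (C , D) → ∣ C ∣ * ∣ D ∣ ≤ M
    size≤M C D adm = subst (∣ C ∣ * ∣ D ∣ ≤_) (sym M≡s*[1+s]) (proj₁ (products C D adm))

    shorter : ∀ {R D : Subset (suc n)} → ∣ R ∣ ≡ s → ∣ D ∣ ≡ suc s → ∣ R ∣ < ∣ D ∣
    shorter ∣R∣≡s ∣D∣≡1+s = ≤-reflexive (trans (cong suc ∣R∣≡s) (sym ∣D∣≡1+s))

    -- A tall rectangle of maximal area inside the union must contain the extra row 0, so only
    -- s − 1 of its rows count for the tie-breaker: (s − 1)(s + 1) < s².
    tall : ∀ C D → Inside (TwoRectangles P Q P′ Q′) C D → ∣ C ∣ ≡ s → ∣ D ∣ ≡ suc s →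
      W (λ i _ → nonzero i) C D < W (λ i _ → nonzero i) P Q
    tall (inside ∷ C′) D C⊠D⊆R ∣C∣≡s ∣D∣≡1+s = begin-strict
      W (λ i _ → nonzero i) (inside ∷ C′) D   ≡⟨ W-nonzero inside C′ D ⟩
      c * ∣ D ∣                              ≡⟨ cong (c *_) (trans ∣D∣≡1+s (cong suc (sym ∣C∣≡s))) ⟩
      c * suc (suc c)                        <⟨ ≤-reflexive (square-deficit c) ⟩
      suc c * suc c                          ≡⟨ cong₂ _*_ c≡ c≡ ⟩
      ∣ A ∣ * ∣ A ∣                          ≡⟨ W-nonzero inside A Q ⟨
      W (λ i _ → nonzero i) P Q              ∎
      where
      open ≤-Reasoning
      c = ∣ C′ ∣
      c≡ : suc c ≡ ∣ A ∣
      c≡ = trans ∣C∣≡s (sym ∣A∣≡s)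
    tall (outside ∷ C′) D C⊠D⊆R ∣C∣≡s ∣D∣≡1+s
      with ∣<∣⇒∃∉ (shorter {Q′} {D} ∣B∣≡s ∣D∣≡1+s) | ∣<∣⇒∃∉ (shorter {Q} {D} ∣A∣≡s ∣D∣≡1+s)
    ... | j , j∈D , j∉Q′ | j′ , j′∈D , j′∉Q = contradiction (trans (sym C′≡A) C′≡B) A≢B
      where
      C′≡A = ⊆∧∣⊇∣⇒≡ (drop-∷-⊆ (column-outside-second C⊠D⊆R j∈D j∉Q′)) (≤-reflexive (trans ∣A∣≡s (sym ∣C∣≡s)))
      C′≡B = ⊆∧∣⊇∣⇒≡ (drop-∷-⊆ (column-outside-first C⊠D⊆R j′∈D j′∉Q)) (≤-reflexive (trans ∣B∣≡s (sym ∣C∣≡s)))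

    classify : ∀ C D → Admissible (2 * s + 1) (C , D) → Inside (TwoRectangles P Q P′ Q′) C D → ∣ C ∣ * ∣ D ∣ ≡ M →
      ((C , D) ≡ (P , Q) ⊎ (C , D) ≡ (P′ , Q′)) ⊎ W (λ i _ → nonzero i) C D < W (λ i _ → nonzero i) P Q
    classify C D adm C⊠D⊆R size≡M with proj₂ (products C D adm) (trans size≡M M≡s*[1+s])
    ... | inj₁ (∣C∣≡s , ∣D∣≡1+s) = inj₂ (tall C D C⊠D⊆R ∣C∣≡s ∣D∣≡1+s)
    ... | inj₂ (∣C∣≡1+s , ∣D∣≡s) = inj₁ (rectangle-in-two C⊠D⊆R a∈P a∉P′ b∈Q′ b∉Q
      (≤-reflexive (trans (cong suc ∣A∣≡s) (sym ∣C∣≡1+s))) (≤-reflexive (trans ∣A∣≡s (sym ∣D∣≡s)))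
      (≤-reflexive (trans (cong suc ∣B∣≡s) (sym ∣C∣≡1+s))) (≤-reflexive (trans ∣B∣≡s (sym ∣D∣≡s))))

    tie : W lex P′ Q′ ≡ W lex P Q
    tie = begin
      W lex P′ Q′                          ≡⟨ W-lex-inside (λ i∈P′ j∈Q′ → inj₂ (i∈P′ , j∈Q′)) ⟩
      suc M * ∣P′∣∣Q′∣ + W h P′ Q′         ≡⟨ cong (suc M * ∣P′∣∣Q′∣ +_) (W-nonzero inside B Q′) ⟩
      suc M * ∣P′∣∣Q′∣ + ∣ B ∣ * ∣ B ∣     ≡⟨ cong (λ t → suc M * (suc t * t) + t * t) (trans ∣B∣≡s (sym ∣A∣≡s)) ⟩
      suc M * M + ∣ A ∣ * ∣ A ∣            ≡⟨ cong (suc M * M +_) (W-nonzero inside A Q) ⟨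
      suc M * M + W h P Q                  ≡⟨ W-lex-inside (λ i∈P j∈Q → inj₁ (i∈P , j∈Q)) ⟨
      W lex P Q                            ∎
      where
      open ≡-Reasoning
      h = λ (i j : Fin (suc n)) → nonzero i
      ∣P′∣∣Q′∣ = suc ∣ B ∣ * ∣ B ∣

open Rectangles

module Cliques where

  open import Data.Nat.Base using (ℕ; zero; suc; _+_; _*_)
  open import Data.Nat.Combinatorics using (_C_; nCk+nC[k+1]≡[n+1]C[k+1])
  open import Data.Fin.Base using (splitAt; join; cast)
  open import Data.Fin.Properties using (join-splitAt; cast-involutive)
  open import Data.Fin.Subset using (Subset; ∣_∣; ⊥; inside; outside)
  open import Data.Fin.Subset.Properties using (∣⊥∣≡0)
  open import Data.Vec.Base using (_∷_)
  open import Data.Vec.Properties using (∷-injective)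

  pascal-split : ∀ n s → Fin (suc n C suc s) → Fin (n C s) ⊎ Fin (n C suc s)
  pascal-split n s = splitAt (n C s) ∘ cast (sym (nCk+nC[k+1]≡[n+1]C[k+1] n s))

  pascal-split-injective : ∀ n s {l l′} → pascal-split n s l ≡ pascal-split n s l′ → l ≡ l′
  pascal-split-injective n s {l} {l′} eq = begin
    l                    ≡⟨ cast-involutive pascal (sym pascal) l ⟨
    cast pascal (cast (sym pascal) l)   ≡⟨ cong (cast pascal) cast-eq ⟩
    cast pascal (cast (sym pascal) l′)  ≡⟨ cast-involutive pascal (sym pascal) l′ ⟩
    l′                   ∎
    where
    open ≡-Reasoning
    pascal = nCk+nC[k+1]≡[n+1]C[k+1] n s
    cast-eq : cast (sym pascal) l ≡ cast (sym pascal) l′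
    cast-eq = begin
      cast (sym pascal) l                                ≡⟨ join-splitAt (n C s) (n C suc s) _ ⟨
      join (n C s) (n C suc s) (pascal-split n s l)      ≡⟨ cong (join (n C s) (n C suc s)) eq ⟩
      join (n C s) (n C suc s) (pascal-split n s l′)     ≡⟨ join-splitAt (n C s) (n C suc s) _ ⟩
      cast (sym pascal) l′                               ∎

  choose : ∀ n s → Fin (n C s) → Subset n
  choose n       zero    _ = ⊥
  choose zero    (suc s) ()
  choose (suc n) (suc s)   = [ (inside ∷_) ∘ choose n s , (outside ∷_) ∘ choose n (suc s) ]′ ∘ pascal-split n s

  ∣choose∣ : ∀ n s l → ∣ choose n s l ∣ ≡ s
  ∣choose∣ n       zero    _ = ∣⊥∣≡0 n
  ∣choose∣ (suc n) (suc s) l with pascal-split n s l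
  ... | inj₁ a = cong suc (∣choose∣ n s a)
  ... | inj₂ b = ∣choose∣ n (suc s) b

  choose-injective : ∀ n s {l l′} → choose n s l ≡ choose n s l′ → l ≡ l′
  choose-injective n       zero    {zero} {zero} _ = refl
  choose-injective (suc n) (suc s) {l} {l′} eq = pascal-split-injective n s (split-injective eq)
    where
    split-injective : ∀ {u u′} → [ (inside ∷_) ∘ choose n s , (outside ∷_) ∘ choose n (suc s) ]′ u
                                ≡ [ (inside ∷_) ∘ choose n s , (outside ∷_) ∘ choose n (suc s) ]′ u′ → u ≡ u′
    split-injective {inj₁ a} {inj₁ a′} eq = cong inj₁ (choose-injective n s (proj₂ (∷-injective eq)))
    split-injective {inj₂ b} {inj₂ b′} eq = cong inj₂ (choose-injective n (suc s) (proj₂ (∷-injective eq)))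
    split-injective {inj₁ a} {inj₂ b′} eq with () ← proj₁ (∷-injective eq)
    split-injective {inj₂ b} {inj₁ a′} eq with () ← proj₁ (∷-injective eq)

  even-clique : ∀ n s → CliqueNumberAtLeast (suc n) (2 * s) (suc n C s)
  even-clique n s = (λ l → χ (A l , A l)) , (λ l → square∈X {C = A l} (∣choose∣ (suc n) s l))
                  , λ l l′ l≢l′ → even-adjacent {A = A l} {A l′} (∣choose∣ (suc n) s l) (∣choose∣ (suc n) s l′)
                                                (l≢l′ ∘ choose-injective (suc n) s)
    where
    A = choose (suc n) s

  odd-clique : ∀ n s → CliqueNumberAtLeast (suc n) (2 * s + 1) (n C s)
  odd-clique n s = (λ l → χ (inside ∷ A l , outside ∷ A l)) , (λ l → flag∈X {C = A l} (∣choose∣ n s l))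
                 , λ l l′ l≢l′ → odd-adjacent {A = A l} {A l′} (∣choose∣ n s l) (∣choose∣ n s l′)
                                              (l≢l′ ∘ choose-injective n s)
    where
    A = choose n s

open Cliques

open import Data.Nat.Base using (ℕ; zero; suc; _≤_; _+_; _*_; _∸_)
open import Data.Nat.Combinatorics using (_C_)

theorem5 : (n k : ℕ) → 1 ≤ n → 1 ≤ k → k ≤ 2 * n → (s : ℕ)
    → (k ≡ 2 * s → CliqueNumberAtLeast n k (n C s))
    × (k ≡ 2 * s + 1 → CliqueNumberAtLeast n k ((n ∸ 1) C s))
theorem5 zero    _ () _ _ _
theorem5 (suc n) k _  _ _ s = (λ { refl → even-clique n s }) , (λ { refl → odd-clique n s })
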